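{- Let $G$ be a connected graph with $n\geq 2$ vertices and $m$ edges, and let $T(G)$ be its triangulation. Then $$R^+(T(G))=2R^+(G)+2R^*(G)+\frac{12m^2-mn-n^2-2m+n}{3}.$$
   Context: All graphs are finite, simple and connected. For a connected graph $H$, the resistance distance $\Omega_{ij}$ between vertices $i,j$ is the effective resistance between $i$ and $j$ in the electrical network obtained from $H$ by replacing each edge with a unit resistor. $d_i$ denotes the degree of vertex $i$ in $H$. The multiplicative degree-Kirchhoff index is $R^*(H)=\sum_{\{i,j\}\subseteq V(H)} d_id_j\Omega_{ij}$ and the additive degree-Kirchhoff index is $R^+(H)=\sum_{\{i,j\}\subseteq V(H)}(d_i+d_j)\Omega_{ij}$, over unordered pairs of distinct vertices. The triangulation $T(G)$ is obtained from $G$ by changing each edge $uv$ into a triangle $uwv$, where $w$ is a new vertex associated with $uv$. -}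

module Defs where

open import Data.Nat as ℕ using (ℕ; zero; suc)
open import Data.Integer as ℤ using (ℤ; +_)
open import Data.Rational as Q using (ℚ; 0ℚ; 1ℚ; _+_; _*_; _-_; _/_)
open import Data.Fin as Fin using (Fin; toℕ; _↑ˡ_; _↑ʳ_)
open import Data.List as List using (List; []; _∷_; _++_; map; allFin; length)
open import Data.List.Relation.Unary.All using (All)
open import Data.List.Relation.Unary.AllPairs using (AllPairs)
open import Data.Product using (_×_; _,_; ∃)
open import Relation.Binary.PropositionalEquality using (_≡_; _≢_)
open import Relation.Nullary using (does)
open import Data.Bool using (Bool; true; false; if_then_else_)

EdgeList : ℕ → Set
EdgeList n = List (Fin n × Fin n)

-- Simple graph: every edge (u , v) has u < v (no loops, canonical orientation)
-- and no edge is listed twice (no multiple edges).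
Simple : ∀ {n} → EdgeList n → Set
Simple es = All (λ e → toℕ (Data.Product.proj₁ e) ℕ.< toℕ (Data.Product.proj₂ e)) es
          × AllPairs _≢_ es

data Adjacent {n} : EdgeList n → Fin n → Fin n → Set where
  here-uv : ∀ {u v es} → Adjacent ((u , v) ∷ es) u v
  here-vu : ∀ {u v es} → Adjacent ((u , v) ∷ es) v u
  there   : ∀ {e es a b} → Adjacent es a b → Adjacent (e ∷ es) a b

data Reachable {n} (es : EdgeList n) : Fin n → Fin n → Set where
  refl-r : ∀ {a} → Reachable es a a
  step   : ∀ {a b c} → Adjacent es a b → Reachable es b c → Reachable es a c

Connected : ∀ {n} → EdgeList n → Set
Connected {n} es = (a b : Fin n) → Reachable es a b

ℕ→ℚ : ℕ → ℚ
ℕ→ℚ k = (+ k) / 1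

sumℚ : List ℚ → ℚ
sumℚ = List.foldr _+_ 0ℚ

deg : ∀ {n} → EdgeList n → Fin n → ℕ
deg [] i = 0
deg ((u , v) ∷ es) i =
  (if does (u Fin.≟ i) then 1 else 0) ℕ.+ (if does (v Fin.≟ i) then 1 else 0) ℕ.+ deg es i

lap : ∀ {n} → EdgeList n → (Fin n → ℚ) → Fin n → ℚ
lap [] x k = 0ℚ
lap ((u , v) ∷ es) x k =
  (if does (u Fin.≟ k) then x u - x v else 0ℚ)
  + (if does (v Fin.≟ k) then x v - x u else 0ℚ)
  + lap es x k

unit : ∀ {n} → Fin n → Fin n → ℚ
unit i k = if does (i Fin.≟ k) then 1ℚ else 0ℚ

-- x is a vector of node potentials when a unit current enters at i and leaves at j
-- (Kirchhoff's current law + Ohm's law with unit resistors): L x = e_i - e_j.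
IsPotential : ∀ {n} → EdgeList n → Fin n → Fin n → (Fin n → ℚ) → Set
IsPotential {n} es i j x = (k : Fin n) → lap es x k ≡ unit i k - unit j k

-- Ω is the resistance-distance function of the network es:
-- Ω i j is the potential difference x_i - x_j under a unit current from i to j.
IsResistance : ∀ {n} → EdgeList n → (Fin n → Fin n → ℚ) → Set
IsResistance {n} es Ω =
  (i j : Fin n) → ∃ λ (x : Fin n → ℚ) → IsPotential es i j x × Ω i j ≡ x i - x j

sumPairs : ∀ n → (Fin n → Fin n → ℚ) → ℚ
sumPairs n f = sumℚ (List.concatMap (λ i → List.map (λ j →
  if does (toℕ i ℕ.<? toℕ j) then f i j else 0ℚ) (allFin n)) (allFin n))

Rstar : ∀ {n} → EdgeList n → (Fin n → Fin n → ℚ) → ℚ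
Rstar {n} es Ω = sumPairs n (λ i j → ℕ→ℚ (deg es i ℕ.* deg es j) * Ω i j)

Rplus : ∀ {n} → EdgeList n → (Fin n → Fin n → ℚ) → ℚ
Rplus {n} es Ω = sumPairs n (λ i j → ℕ→ℚ (deg es i ℕ.+ deg es j) * Ω i j)

-- Triangulation T(G): vertices Fin (n + m); old vertex u ↦ u ↑ˡ m,
-- the new vertex of the k-th edge ↦ n ↑ʳ k. Edges: all old edges, and
-- for the k-th edge (u , v) the two edges u—w_k and v—w_k.
triEdges : ∀ {n} (es : EdgeList n) → EdgeList (n ℕ.+ length es)
triEdges {n} es =
  map (λ e → (Data.Product.proj₁ e ↑ˡ m) , (Data.Product.proj₂ e ↑ˡ m)) es
  ++ List.concatMap (λ k → let e = List.lookup es k in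
       ((Data.Product.proj₁ e ↑ˡ m) , n ↑ʳ k)
       ∷ ((Data.Product.proj₂ e ↑ˡ m) , n ↑ʳ k) ∷ []) (allFin m)
  where m = length es

-- Fix a root r. A Green function grounded at r assigns to each vertex a the potential Y a of a
-- unit current from a to r; then Ω a b = Y a a − Y b a − Y a b + Y b b and Y is symmetric, so both
-- degree-Kirchhoff indices become degree-weighted sums of entries of Y. For T(G) such a Green
-- function is explicit in terms of a grounded Green function M of G: a source at an old vertex i
-- gives ⅔ M i on the old vertices and ⅓ (M i u + M i v) at the new vertex of the edge uv; a source
-- at the new vertex of uv gives the same for ½ (M u + M v), plus ½ at that vertex. Then R⁺(T(G)),
-- R⁺(G) and R*(G) are all expressed through n, m, Σ M i i, Σ d i M i i, Σ d i M i j,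
-- Σ d i d j M i j and Σ_{uv ∈ E} Ω u v, and the last one is n − 1 by Foster's theorem.

module Submission where

open import Defs
open import Data.Nat as ℕ using (ℕ; zero; suc)
import Data.Nat.Properties as ℕₚ
import Data.Integer as ℤ
import Data.Integer.Properties as ℤₚ
import Data.Integer.Solver as ℤSolver
open import Data.Rational as Q using (ℚ; 0ℚ; 1ℚ; _+_; _*_; _-_; -_; _/_; _≤_; 1/_; toℚᵘ)
import Data.Rational.Properties as Qₚ
import Data.Rational.Unnormalised as ℚᵘ
import Data.Rational.Unnormalised.Properties as ℚᵘₚ
open import Data.Rational.Solver using (module +-*-Solver)
open import Data.Fin as Fin using (Fin; zero; suc; toℕ; _↑ˡ_; _↑ʳ_; splitAt)
import Data.Fin.Properties as Finₚ
open import Data.List as List using (List; []; _∷_; _++_; map; allFin; tabulate; length; concatMap; lookup)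
open import Data.List.Membership.Propositional using (_∈_)
open import Data.List.Membership.Propositional.Properties using (∈-allFin)
open import Data.List.Relation.Unary.Any using (here; there)
open import Data.Product using (_×_; _,_; proj₁; proj₂; ∃)
open import Data.Sum using (inj₁; inj₂; [_,_]′)
open import Data.Bool using (Bool; true; false; if_then_else_)
open import Data.Empty using (⊥-elim)
open import Function using (_∘_)
open import Relation.Nullary using (does; yes; no; Dec)
open import Relation.Nullary.Decidable using (dec-true; dec-false)
open import Relation.Binary.PropositionalEquality
open import Algebra.Bundles using (CommutativeRing)
open import Algebra.Properties.Semiring.Sum (CommutativeRing.semiring Qₚ.+-*-commutativeRing)
  using (sum; sum-syntax; sum-cong-≗; ∑-distrib-+; ∑-comm; *-distribˡ-sum; *-distribʳ-sum; sum-replicate-zero)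

open +-*-Solver
open ≡-Reasoning

when : Bool → ℚ → ℚ
when b p = if b then p else 0ℚ

½ ⅓ ⅔ ⅙ : ℚ
½ = Q.½
⅓ = ℤ.+ 1 / 3
⅔ = ℤ.+ 2 / 3
⅙ = ℤ.+ 1 / 6

module _ where
  open ℤSolver.+-*-Solver using ()
    renaming (Polynomial to Polynomialℤ; solve to solveℤ; _:+_ to _⊕_; _:*_ to _⊗_; _:-_ to _⊖_; :-_ to ⊝_; _:=_ to _≐_; con to k̂)
  open ℚᵘₚ.≃-Reasoning renaming (begin_ to beginᵘ_; _∎ to _∎ᵘ)

  ı : ∀ {k} → Polynomialℤ k
  ı = k̂ (ℤ.+ 1)

  toℚᵘ-/1 : ∀ z → toℚᵘ (z / 1) ℚᵘ.≃ ℚᵘ.mkℚᵘ z 0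
  toℚᵘ-/1 z = Qₚ.toℚᵘ-fromℚᵘ (ℚᵘ.mkℚᵘ z 0)

  /1-homo-+ : ∀ p q → (p ℤ.+ q) / 1 ≡ p / 1 + q / 1
  /1-homo-+ p q = Qₚ.toℚᵘ-injective (beginᵘ
    toℚᵘ ((p ℤ.+ q) / 1)
      ≈⟨ toℚᵘ-/1 (p ℤ.+ q) ⟩
    ℚᵘ.mkℚᵘ (p ℤ.+ q) 0
      ≈⟨ ℚᵘ.*≡* (solveℤ 2 (λ p q → (p ⊕ q) ⊗ (ı ⊗ ı) ≐ (p ⊗ ı ⊕ q ⊗ ı) ⊗ ı) refl p q) ⟩
    ℚᵘ.mkℚᵘ p 0 ℚᵘ.+ ℚᵘ.mkℚᵘ q 0
      ≈⟨ ℚᵘₚ.+-cong (toℚᵘ-/1 p) (toℚᵘ-/1 q) ⟨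
    toℚᵘ (p / 1) ℚᵘ.+ toℚᵘ (q / 1)
      ≈⟨ Qₚ.toℚᵘ-homo-+ (p / 1) (q / 1) ⟨
    toℚᵘ (p / 1 + q / 1) ∎ᵘ)

  /1-homo-* : ∀ p q → (p ℤ.* q) / 1 ≡ (p / 1) * (q / 1)
  /1-homo-* p q = Qₚ.toℚᵘ-injective (beginᵘ
    toℚᵘ ((p ℤ.* q) / 1)
      ≈⟨ toℚᵘ-/1 (p ℤ.* q) ⟩
    ℚᵘ.mkℚᵘ (p ℤ.* q) 0
      ≈⟨ ℚᵘ.*≡* (solveℤ 2 (λ p q → (p ⊗ q) ⊗ (ı ⊗ ı) ≐ (p ⊗ q) ⊗ ı) refl p q) ⟩
    ℚᵘ.mkℚᵘ p 0 ℚᵘ.* ℚᵘ.mkℚᵘ q 0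
      ≈⟨ ℚᵘₚ.*-cong (toℚᵘ-/1 p) (toℚᵘ-/1 q) ⟨
    toℚᵘ (p / 1) ℚᵘ.* toℚᵘ (q / 1)
      ≈⟨ Qₚ.toℚᵘ-homo-* (p / 1) (q / 1) ⟨
    toℚᵘ ((p / 1) * (q / 1)) ∎ᵘ)

  /1-homo-minus : ∀ p q → (p ℤ.- q) / 1 ≡ p / 1 - q / 1
  /1-homo-minus p q = Qₚ.toℚᵘ-injective (beginᵘ
    toℚᵘ ((p ℤ.- q) / 1)
      ≈⟨ toℚᵘ-/1 (p ℤ.- q) ⟩
    ℚᵘ.mkℚᵘ (p ℤ.- q) 0
      ≈⟨ ℚᵘ.*≡* (solveℤ 2 (λ p q → (p ⊖ q) ⊗ (ı ⊗ ı) ≐ (p ⊗ ı ⊕ (⊝ q) ⊗ ı) ⊗ ı) refl p q) ⟩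
    ℚᵘ.mkℚᵘ p 0 ℚᵘ.- ℚᵘ.mkℚᵘ q 0
      ≈⟨ ℚᵘₚ.+-cong (toℚᵘ-/1 p) (ℚᵘₚ.-‿cong (toℚᵘ-/1 q)) ⟨
    toℚᵘ (p / 1) ℚᵘ.- toℚᵘ (q / 1)
      ≈⟨ ℚᵘₚ.+-congʳ (toℚᵘ (p / 1)) (Qₚ.toℚᵘ-homo‿- (q / 1)) ⟨
    toℚᵘ (p / 1) ℚᵘ.+ toℚᵘ (- (q / 1))
      ≈⟨ Qₚ.toℚᵘ-homo-+ (p / 1) (- (q / 1)) ⟨
    toℚᵘ (p / 1 - q / 1) ∎ᵘ)

  /3≡/1*⅓ : ∀ z → z / 3 ≡ z / 1 * ⅓
  /3≡/1*⅓ z = Qₚ.toℚᵘ-injective (beginᵘ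
    toℚᵘ (z / 3)
      ≈⟨ Qₚ.toℚᵘ-fromℚᵘ (ℚᵘ.mkℚᵘ z 2) ⟩
    ℚᵘ.mkℚᵘ z 2
      ≈⟨ ℚᵘ.*≡* (solveℤ 1 (λ z → z ⊗ (ı ⊗ k̂ (ℤ.+ 3)) ≐ (z ⊗ ı) ⊗ k̂ (ℤ.+ 3)) refl z) ⟩
    ℚᵘ.mkℚᵘ z 0 ℚᵘ.* ℚᵘ.mkℚᵘ (ℤ.+ 1) 2
      ≈⟨ ℚᵘₚ.*-cong (toℚᵘ-/1 z) (Qₚ.toℚᵘ-fromℚᵘ (ℚᵘ.mkℚᵘ (ℤ.+ 1) 2)) ⟨
    toℚᵘ (z / 1) ℚᵘ.* toℚᵘ ⅓
      ≈⟨ Qₚ.toℚᵘ-homo-* (z / 1) ⅓ ⟨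
    toℚᵘ (z / 1 * ⅓) ∎ᵘ)

ℕ→ℚ-+ : ∀ a b → ℕ→ℚ (a ℕ.+ b) ≡ ℕ→ℚ a + ℕ→ℚ b
ℕ→ℚ-+ a b = trans (cong (_/ 1) (ℤₚ.pos-+ a b)) (/1-homo-+ (ℤ.+ a) (ℤ.+ b))

ℕ→ℚ-* : ∀ a b → ℕ→ℚ (a ℕ.* b) ≡ ℕ→ℚ a * ℕ→ℚ b
ℕ→ℚ-* a b = trans (cong (_/ 1) (ℤₚ.pos-* a b)) (/1-homo-* (ℤ.+ a) (ℤ.+ b))

x*x-nonNeg : ∀ p → 0ℚ ≤ p * p
x*x-nonNeg p with Qₚ.≤-total 0ℚ p
... | inj₁ 0≤p = Qₚ.nonNegative⁻¹ (p * p) {{Qₚ.nonNeg*nonNeg⇒nonNeg p {{Q.nonNegative 0≤p}} p {{Q.nonNegative 0≤p}}}}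
... | inj₂ p≤0 = Qₚ.nonNegative⁻¹ (p * p) {{Qₚ.nonPos*nonPos⇒nonPos p {{Q.nonPositive p≤0}} p {{Q.nonPositive p≤0}}}}

x*x≡0⇒x≡0 : ∀ p → p * p ≡ 0ℚ → p ≡ 0ℚ
x*x≡0⇒x≡0 p pp≡0 with p Qₚ.≟ 0ℚ
... | yes p≡0 = p≡0
... | no p≢0 = begin
  p                ≡⟨ Qₚ.*-identityʳ p ⟨
  p * 1ℚ           ≡⟨ cong (p *_) (Qₚ.*-inverseʳ p) ⟨
  p * (p * 1/ p)   ≡⟨ Qₚ.*-assoc p p (1/ p) ⟨
  p * p * 1/ p     ≡⟨ cong (_* 1/ p) pp≡0 ⟩
  0ℚ * 1/ p        ≡⟨ Qₚ.*-zeroˡ (1/ p) ⟩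
  0ℚ               ∎
  where instance _ = Q.≢-nonZero p≢0

nonNeg+nonNeg≡0 : ∀ {p q} → 0ℚ ≤ p → 0ℚ ≤ q → p + q ≡ 0ℚ → p ≡ 0ℚ × q ≡ 0ℚ
nonNeg+nonNeg≡0 {p} {q} 0≤p 0≤q p+q≡0 = Qₚ.≤-antisym p≤0 0≤p , Qₚ.≤-antisym q≤0 0≤q
  where
  p≤0 : p ≤ 0ℚ
  p≤0 = Qₚ.≤-trans (Qₚ.≤-reflexive (sym (Qₚ.+-identityʳ p)))
          (Qₚ.≤-trans (Qₚ.+-monoʳ-≤ p 0≤q) (Qₚ.≤-reflexive p+q≡0))
  q≤0 : q ≤ 0ℚ
  q≤0 = Qₚ.≤-trans (Qₚ.≤-reflexive (sym (Qₚ.+-identityˡ q)))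
          (Qₚ.≤-trans (Qₚ.+-monoˡ-≤ q 0≤p) (Qₚ.≤-reflexive p+q≡0))

p-q≡0⇒p≡q : ∀ p q → p - q ≡ 0ℚ → p ≡ q
p-q≡0⇒p≡q p q p-q≡0 = begin
  p            ≡⟨ solve 2 (λ p q → p := p :- q :+ q) refl p q ⟩
  p - q + q    ≡⟨ cong (_+ q) p-q≡0 ⟩
  0ℚ + q       ≡⟨ Qₚ.+-identityˡ q ⟩
  q            ∎

p+p≡q+q⇒p≡q : ∀ p q → p + p ≡ q + q → p ≡ q
p+p≡q+q⇒p≡q p q p+p≡q+q = begin
  p                      ≡⟨ solve 1 (λ p → p := con ½ :* (p :+ p)) refl p ⟩
  ½ * (p + p)            ≡⟨ cong (½ *_) p+p≡q+q ⟩
  ½ * (q + q)            ≡⟨ solve 1 (λ q → con ½ :* (q :+ q) := q) refl q ⟩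
  q                      ∎

∑-distrib-minus : ∀ {N} (f g : Fin N → ℚ) → ∑[ k < N ] (f k - g k) ≡ sum f - sum g
∑-distrib-minus {zero} f g = refl
∑-distrib-minus {suc N} f g = begin
  f zero - g zero + ∑[ k < N ] (f (suc k) - g (suc k))
    ≡⟨ cong ((f zero - g zero) +_) (∑-distrib-minus (λ k → f (suc k)) (λ k → g (suc k))) ⟩
  f zero - g zero + (∑[ k < N ] f (suc k) - ∑[ k < N ] g (suc k))
    ≡⟨ solve 4 (λ a b c d → a :- b :+ (c :- d) := a :+ c :- (b :+ d)) refl
         (f zero) (g zero) (∑[ k < N ] f (suc k)) (∑[ k < N ] g (suc k)) ⟩
  (f zero + ∑[ k < N ] f (suc k)) - (g zero + ∑[ k < N ] g (suc k)) ∎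

∑-↑ : ∀ n m (f : Fin (n ℕ.+ m) → ℚ) → sum f ≡ ∑[ i < n ] f (i ↑ˡ m) + ∑[ k < m ] f (n ↑ʳ k)
∑-↑ zero m f = sym (Qₚ.+-identityˡ _)
∑-↑ (suc n) m f = trans (cong (f zero +_) (∑-↑ n m (λ k → f (suc k))))
  (sym (Qₚ.+-assoc (f zero) _ _))

∑-when-≟ : ∀ {N} (i : Fin N) (c : Fin N → ℚ) → ∑[ k < N ] when (does (i Fin.≟ k)) (c k) ≡ c i
∑-when-≟ {suc N} zero c =
  trans (cong (c zero +_) (sum-replicate-zero N)) (Qₚ.+-identityʳ _)
∑-when-≟ {suc N} (suc i) c = trans (Qₚ.+-identityˡ _) (∑-when-≟ i (λ k → c (suc k)))

private variable A B : Set

∑ₗ : List A → (A → ℚ) → ℚ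
∑ₗ []       f = 0ℚ
∑ₗ (x ∷ xs) f = f x + ∑ₗ xs f

∑ₗ-cong : ∀ (xs : List A) {f g : A → ℚ} → (∀ x → f x ≡ g x) → ∑ₗ xs f ≡ ∑ₗ xs g
∑ₗ-cong []       eq = refl
∑ₗ-cong (x ∷ xs) eq = cong₂ _+_ (eq x) (∑ₗ-cong xs eq)

∑ₗ-++ : ∀ (xs ys : List A) f → ∑ₗ (xs ++ ys) f ≡ ∑ₗ xs f + ∑ₗ ys f
∑ₗ-++ []       ys f = sym (Qₚ.+-identityˡ _)
∑ₗ-++ (x ∷ xs) ys f =
  trans (cong (f x +_) (∑ₗ-++ xs ys f)) (sym (Qₚ.+-assoc (f x) (∑ₗ xs f) (∑ₗ ys f)))

∑ₗ-map : ∀ (g : A → B) xs (f : B → ℚ) → ∑ₗ (map g xs) f ≡ ∑ₗ xs (λ x → f (g x))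
∑ₗ-map g []       f = refl
∑ₗ-map g (x ∷ xs) f = cong (f (g x) +_) (∑ₗ-map g xs f)

∑ₗ-concatMap : ∀ (g : A → List B) xs (f : B → ℚ) →
  ∑ₗ (concatMap g xs) f ≡ ∑ₗ xs (λ x → ∑ₗ (g x) f)
∑ₗ-concatMap g []       f = refl
∑ₗ-concatMap g (x ∷ xs) f =
  trans (∑ₗ-++ (g x) (concatMap g xs) f) (cong (∑ₗ (g x) f +_) (∑ₗ-concatMap g xs f))

∑ₗ-lookup : ∀ (xs : List A) (f : A → ℚ) → ∑[ k < length xs ] f (lookup xs k) ≡ ∑ₗ xs f
∑ₗ-lookup []       f = refl
∑ₗ-lookup (x ∷ xs) f = cong (f x +_) (∑ₗ-lookup xs f)

∑ₗ-tabulate : ∀ N (g : Fin N → A) (f : A → ℚ) → ∑ₗ (tabulate g) f ≡ ∑[ k < N ] f (g k)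
∑ₗ-tabulate zero    g f = refl
∑ₗ-tabulate (suc N) g f = cong (f (g zero) +_) (∑ₗ-tabulate N (λ k → g (suc k)) f)

∑ₗ-allFin : ∀ N (f : Fin N → ℚ) → ∑ₗ (allFin N) f ≡ sum f
∑ₗ-allFin N f = ∑ₗ-tabulate N (λ k → k) f

sumℚ≡∑ₗ : ∀ xs → sumℚ xs ≡ ∑ₗ xs (λ x → x)
sumℚ≡∑ₗ []       = refl
sumℚ≡∑ₗ (x ∷ xs) = cong (x +_) (sumℚ≡∑ₗ xs)

∑-const : ∀ N c → ∑[ k < N ] c ≡ ℕ→ℚ N * c
∑-const zero    c = sym (Qₚ.*-zeroˡ c)
∑-const (suc N) c = begin
  c + ∑[ k < N ] c           ≡⟨ cong (c +_) (∑-const N c) ⟩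
  c + ℕ→ℚ N * c              ≡⟨ solve 2 (λ c n → c :+ n :* c := (con 1ℚ :+ n) :* c) refl c (ℕ→ℚ N) ⟩
  (1ℚ + ℕ→ℚ N) * c           ≡⟨ cong (_* c) (ℕ→ℚ-+ 1 N) ⟨
  ℕ→ℚ (suc N) * c            ∎

∑-affine : ∀ {K} (a b c : ℚ) (f g : Fin K → ℚ) → ∑[ k < K ] (a * f k + b * g k + c) ≡ a * sum f + b * sum g + ℕ→ℚ K * c
∑-affine {K} a b c f g = begin
  ∑[ k < K ] (a * f k + b * g k + c)              ≡⟨ ∑-distrib-+ (λ k → a * f k + b * g k) (λ _ → c) ⟩
  ∑[ k < K ] (a * f k + b * g k) + ∑[ k < K ] c    ≡⟨ cong₂ _+_ (∑-distrib-+ (λ k → a * f k) (λ k → b * g k)) (∑-const K c) ⟩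
  ∑[ k < K ] (a * f k) + ∑[ k < K ] (b * g k) + ℕ→ℚ K * c
    ≡⟨ cong₂ (λ p q → p + q + ℕ→ℚ K * c) (*-distribˡ-sum a f) (*-distribˡ-sum b g) ⟨
  a * sum f + b * sum g + ℕ→ℚ K * c ∎

-- Laplacian and Dirichlet form

module _ {N : ℕ} where

  lap-cong : ∀ (es : EdgeList N) {x y : Fin N → ℚ} → (∀ v → x v ≡ y v) → ∀ k → lap es x k ≡ lap es y k
  lap-cong []             x≗y k = refl
  lap-cong ((u , v) ∷ es) x≗y k = cong₂ _+_
    (cong₂ _+_ (cong (when (does (u Fin.≟ k))) (cong₂ _-_ (x≗y u) (x≗y v)))
               (cong (when (does (v Fin.≟ k))) (cong₂ _-_ (x≗y v) (x≗y u))))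
    (lap-cong es x≗y k)

  lap-affine : ∀ (es : EdgeList N) (a b c : ℚ) (x y : Fin N → ℚ) k →
    lap es (λ v → a * x v + b * y v + c) k ≡ a * lap es x k + b * lap es y k
  lap-affine []             a b c x y k = solve 2 (λ a b → con 0ℚ := a :* con 0ℚ :+ b :* con 0ℚ) refl a b
  lap-affine ((u , v) ∷ es) a b c x y k = begin
    edge (λ w → a * x w + b * y w + c) + lap es (λ w → a * x w + b * y w + c) k
      ≡⟨ cong₂ _+_ (edge-affine (does (u Fin.≟ k)) (does (v Fin.≟ k))) (lap-affine es a b c x y k) ⟩
    (a * edge x + b * edge y) + (a * lap es x k + b * lap es y k)
      ≡⟨ solve 6 (λ a b X Y Lx Ly → a :* X :+ b :* Y :+ (a :* Lx :+ b :* Ly) := a :* (X :+ Lx) :+ b :* (Y :+ Ly))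
           refl a b (edge x) (edge y) (lap es x k) (lap es y k) ⟩
    a * (edge x + lap es x k) + b * (edge y + lap es y k) ∎
    where
    edgeAt : Bool → Bool → (Fin N → ℚ) → ℚ
    edgeAt d₁ d₂ z = when d₁ (z u - z v) + when d₂ (z v - z u)
    edge : (Fin N → ℚ) → ℚ
    edge = edgeAt (does (u Fin.≟ k)) (does (v Fin.≟ k))
    edge-affine : ∀ d₁ d₂ → edgeAt d₁ d₂ (λ w → a * x w + b * y w + c) ≡ a * edgeAt d₁ d₂ x + b * edgeAt d₁ d₂ y
    edge-affine true  true  = solve 7 (λ a b c xu xv yu yv →
      (a :* xu :+ b :* yu :+ c :- (a :* xv :+ b :* yv :+ c)) :+ (a :* xv :+ b :* yv :+ c :- (a :* xu :+ b :* yu :+ c))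
      := a :* ((xu :- xv) :+ (xv :- xu)) :+ b :* ((yu :- yv) :+ (yv :- yu))) refl a b c (x u) (x v) (y u) (y v)
    edge-affine true  false = solve 7 (λ a b c xu xv yu yv →
      (a :* xu :+ b :* yu :+ c :- (a :* xv :+ b :* yv :+ c)) :+ con 0ℚ
      := a :* ((xu :- xv) :+ con 0ℚ) :+ b :* ((yu :- yv) :+ con 0ℚ)) refl a b c (x u) (x v) (y u) (y v)
    edge-affine false true  = solve 7 (λ a b c xu xv yu yv →
      con 0ℚ :+ (a :* xv :+ b :* yv :+ c :- (a :* xu :+ b :* yu :+ c))
      := a :* (con 0ℚ :+ (xv :- xu)) :+ b :* (con 0ℚ :+ (yv :- yu))) refl a b c (x u) (x v) (y u) (y v)
    edge-affine false false = solve 2 (λ a b → con 0ℚ :+ con 0ℚ := a :* (con 0ℚ :+ con 0ℚ) :+ b :* (con 0ℚ :+ con 0ℚ)) refl a b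

  lap-difference : ∀ (es : EdgeList N) (x y : Fin N → ℚ) k → lap es (λ v → x v - y v) k ≡ lap es x k - lap es y k
  lap-difference es x y k = begin
    lap es (λ v → x v - y v) k
      ≡⟨ lap-cong es (λ v → solve 2 (λ x y → x :- y := con 1ℚ :* x :+ con (- 1ℚ) :* y :+ con 0ℚ) refl (x v) (y v)) k ⟩
    lap es (λ v → 1ℚ * x v + (- 1ℚ) * y v + 0ℚ) k
      ≡⟨ lap-affine es 1ℚ (- 1ℚ) 0ℚ x y k ⟩
    1ℚ * lap es x k + (- 1ℚ) * lap es y k
      ≡⟨ solve 2 (λ p q → con 1ℚ :* p :+ con (- 1ℚ) :* q := p :- q) refl (lap es x k) (lap es y k) ⟩
    lap es x k - lap es y k ∎

  dirichlet : EdgeList N → (Fin N → ℚ) → (Fin N → ℚ) → ℚ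
  dirichlet []             y x = 0ℚ
  dirichlet ((u , v) ∷ es) y x = (y u - y v) * (x u - x v) + dirichlet es y x

  ∑-*-when-≟ : ∀ (y : Fin N → ℚ) u c → ∑[ k < N ] (y k * when (does (u Fin.≟ k)) c) ≡ y u * c
  ∑-*-when-≟ y u c = trans (sum-cong-≗ (λ k → distrib (does (u Fin.≟ k)) (y k))) (∑-when-≟ u (λ k → y k * c))
    where
    distrib : ∀ d p → p * when d c ≡ when d (p * c)
    distrib true  p = refl
    distrib false p = Qₚ.*-zeroʳ p

  ∑-*-lap : ∀ (es : EdgeList N) (y x : Fin N → ℚ) → ∑[ k < N ] (y k * lap es x k) ≡ dirichlet es y x
  ∑-*-lap []             y x = trans (sum-cong-≗ (λ k → Qₚ.*-zeroʳ (y k))) (sum-replicate-zero N)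
  ∑-*-lap ((u , v) ∷ es) y x = begin
    ∑[ k < N ] (y k * (atU k + atV k + lap es x k))
      ≡⟨ sum-cong-≗ (λ k → solve 4 (λ y a b l → y :* (a :+ b :+ l) := y :* a :+ y :* b :+ y :* l) refl
           (y k) (atU k) (atV k) (lap es x k)) ⟩
    ∑[ k < N ] (y k * atU k + y k * atV k + y k * lap es x k)
      ≡⟨ trans (∑-distrib-+ (λ k → y k * atU k + y k * atV k) (λ k → y k * lap es x k))
           (cong (_+ _) (∑-distrib-+ (λ k → y k * atU k) (λ k → y k * atV k))) ⟩
    ∑[ k < N ] (y k * atU k) + ∑[ k < N ] (y k * atV k) + ∑[ k < N ] (y k * lap es x k)
      ≡⟨ cong₂ _+_ (cong₂ _+_ (∑-*-when-≟ y u (x u - x v)) (∑-*-when-≟ y v (x v - x u))) (∑-*-lap es y x) ⟩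
    y u * (x u - x v) + y v * (x v - x u) + dirichlet es y x
      ≡⟨ cong (_+ dirichlet es y x) (solve 4 (λ yu yv xu xv → yu :* (xu :- xv) :+ yv :* (xv :- xu) := (yu :- yv) :* (xu :- xv))
           refl (y u) (y v) (x u) (x v)) ⟩
    (y u - y v) * (x u - x v) + dirichlet es y x ∎
    where
    atU atV : Fin N → ℚ
    atU k = when (does (u Fin.≟ k)) (x u - x v)
    atV k = when (does (v Fin.≟ k)) (x v - x u)

  dirichlet-comm : ∀ (es : EdgeList N) y x → dirichlet es y x ≡ dirichlet es x y
  dirichlet-comm []             y x = refl
  dirichlet-comm ((u , v) ∷ es) y x = cong₂ _+_ (Qₚ.*-comm (y u - y v) (x u - x v)) (dirichlet-comm es y x)

  dirichlet-nonNeg : ∀ (es : EdgeList N) z → 0ℚ ≤ dirichlet es z z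
  dirichlet-nonNeg []             z = Qₚ.≤-refl
  dirichlet-nonNeg ((u , v) ∷ es) z = Qₚ.≤-trans (Qₚ.≤-reflexive (sym (Qₚ.+-identityʳ 0ℚ)))
    (Qₚ.+-mono-≤ (x*x-nonNeg (z u - z v)) (dirichlet-nonNeg es z))

  dirichlet≡0⇒adjacent-equal : ∀ {es : EdgeList N} z → dirichlet es z z ≡ 0ℚ → ∀ {a b} → Adjacent es a b → z a ≡ z b
  dirichlet≡0⇒adjacent-equal {(u , v) ∷ es} z E≡0 adj with nonNeg+nonNeg≡0 (x*x-nonNeg (z u - z v)) (dirichlet-nonNeg es z) E≡0
  ... | edge≡0 , rest≡0 with adj
  ...   | here-uv   = p-q≡0⇒p≡q (z u) (z v) (x*x≡0⇒x≡0 (z u - z v) edge≡0)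
  ...   | here-vu   = sym (p-q≡0⇒p≡q (z u) (z v) (x*x≡0⇒x≡0 (z u - z v) edge≡0))
  ...   | there adj′ = dirichlet≡0⇒adjacent-equal z rest≡0 adj′

  dirichlet≡0⇒reachable-equal : ∀ {es : EdgeList N} z → dirichlet es z z ≡ 0ℚ → ∀ {a b} → Reachable es a b → z a ≡ z b
  dirichlet≡0⇒reachable-equal z E≡0 refl-r          = refl
  dirichlet≡0⇒reachable-equal z E≡0 (step adj path) =
    trans (dirichlet≡0⇒adjacent-equal z E≡0 adj) (dirichlet≡0⇒reachable-equal z E≡0 path)

  harmonic⇒constant : ∀ (es : EdgeList N) z → Connected es → (∀ k → lap es z k ≡ 0ℚ) → ∀ a b → z a ≡ z b
  harmonic⇒constant es z connected harmonic a b = dirichlet≡0⇒reachable-equal z E≡0 (connected a b)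
    where
    E≡0 : dirichlet es z z ≡ 0ℚ
    E≡0 = begin
      dirichlet es z z                ≡⟨ ∑-*-lap es z z ⟨
      ∑[ k < N ] (z k * lap es z k)   ≡⟨ sum-cong-≗ (λ k → trans (cong (z k *_) (harmonic k)) (Qₚ.*-zeroʳ (z k))) ⟩
      ∑[ k < N ] 0ℚ                   ≡⟨ sum-replicate-zero N ⟩
      0ℚ                              ∎

  potential-differences-unique : ∀ (es : EdgeList N) {i j} x y → Connected es →
    IsPotential es i j x → IsPotential es i j y → ∀ a b → x a - x b ≡ y a - y b
  potential-differences-unique es {i} {j} x y connected x-pot y-pot a b = begin
    x a - x b                  ≡⟨ solve 4 (λ xa xb ya yb → xa :- xb := (xa :- ya) :- (xb :- yb) :+ (ya :- yb)) refl (x a) (x b) (y a) (y b) ⟩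
    z a - z b + (y a - y b)    ≡⟨ cong (λ t → t - z b + (y a - y b)) (harmonic⇒constant es z connected z-harmonic a b) ⟩
    z b - z b + (y a - y b)    ≡⟨ solve 2 (λ p q → p :- p :+ q := q) refl (z b) (y a - y b) ⟩
    y a - y b                  ∎
    where
    z : Fin N → ℚ
    z v = x v - y v
    z-harmonic : ∀ k → lap es z k ≡ 0ℚ
    z-harmonic k = begin
      lap es z k                                   ≡⟨ lap-difference es x y k ⟩
      lap es x k - lap es y k                      ≡⟨ cong₂ _-_ (x-pot k) (y-pot k) ⟩
      (unit i k - unit j k) - (unit i k - unit j k) ≡⟨ Qₚ.+-inverseʳ (unit i k - unit j k) ⟩
      0ℚ                                           ∎

-- Green functions and effective resistance

IsGreen : ∀ {N} → EdgeList N → Fin N → (Fin N → Fin N → ℚ) → Set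
IsGreen {N} es r Y = (a : Fin N) → IsPotential es a r (Y a)

resistanceOf : ∀ {N} → (Fin N → Fin N → ℚ) → Fin N → Fin N → ℚ
resistanceOf Y a b = Y a a - Y b a - Y a b + Y b b

module _ {N : ℕ} (es : EdgeList N) (r : Fin N) {Y : Fin N → Fin N → ℚ} (green : IsGreen es r Y) where

  resistance-green : ∀ {Ω} → Connected es → IsResistance es Ω → ∀ a b → Ω a b ≡ resistanceOf Y a b
  resistance-green {Ω} connected resistance a b = begin
    Ω a b       ≡⟨ proj₂ (proj₂ (resistance a b)) ⟩
    x a - x b   ≡⟨ potential-differences-unique es {a} {b} x y connected (proj₁ (proj₂ (resistance a b))) y-pot a b ⟩
    y a - y b   ≡⟨ solve 4 (λ aa ba ab bb → aa :- ba :- (ab :- bb) := aa :- ba :- ab :+ bb) refl (Y a a) (Y b a) (Y a b) (Y b b) ⟩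
    resistanceOf Y a b ∎
    where
    x = proj₁ (resistance a b)
    y : Fin N → ℚ
    y v = Y a v - Y b v
    y-pot : IsPotential es a b y
    y-pot k = begin
      lap es y k                                    ≡⟨ lap-difference es (Y a) (Y b) k ⟩
      lap es (Y a) k - lap es (Y b) k               ≡⟨ cong₂ _-_ (green a k) (green b k) ⟩
      (unit a k - unit r k) - (unit b k - unit r k)
        ≡⟨ solve 3 (λ p q s → (p :- s) :- (q :- s) := p :- q) refl (unit a k) (unit b k) (unit r k) ⟩
      unit a k - unit b k ∎

  ∑-*-lap-green : (∀ a → Y a r ≡ 0ℚ) → ∀ a b → ∑[ k < N ] (Y a k * lap es (Y b) k) ≡ Y a b
  ∑-*-lap-green grounded a b = begin
    ∑[ k < N ] (Y a k * lap es (Y b) k)                   ≡⟨ sum-cong-≗ (λ k → cong (Y a k *_) (green b k)) ⟩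
    ∑[ k < N ] (Y a k * (unit b k - unit r k))
      ≡⟨ sum-cong-≗ (λ k → solve 3 (λ y p q → y :* (p :- q) := y :* p :- y :* q) refl (Y a k) (unit b k) (unit r k)) ⟩
    ∑[ k < N ] (Y a k * unit b k - Y a k * unit r k)     ≡⟨ ∑-distrib-minus (λ k → Y a k * unit b k) (λ k → Y a k * unit r k) ⟩
    ∑[ k < N ] (Y a k * unit b k) - ∑[ k < N ] (Y a k * unit r k)
      ≡⟨ cong₂ _-_ (∑-*-when-≟ (Y a) b 1ℚ) (∑-*-when-≟ (Y a) r 1ℚ) ⟩
    Y a b * 1ℚ - Y a r * 1ℚ                               ≡⟨ cong (λ t → Y a b * 1ℚ - t * 1ℚ) (grounded a) ⟩
    Y a b * 1ℚ - 0ℚ * 1ℚ                                  ≡⟨ solve 1 (λ y → y :* con 1ℚ :- con 0ℚ :* con 1ℚ := y) refl (Y a b) ⟩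
    Y a b                                                 ∎

  green-sym : (∀ a → Y a r ≡ 0ℚ) → ∀ a b → Y a b ≡ Y b a
  green-sym grounded a b = begin
    Y a b                                ≡⟨ ∑-*-lap-green grounded a b ⟨
    ∑[ k < N ] (Y a k * lap es (Y b) k)  ≡⟨ ∑-*-lap es (Y a) (Y b) ⟩
    dirichlet es (Y a) (Y b)             ≡⟨ dirichlet-comm es (Y a) (Y b) ⟩
    dirichlet es (Y b) (Y a)             ≡⟨ ∑-*-lap es (Y b) (Y a) ⟨
    ∑[ k < N ] (Y b k * lap es (Y a) k)  ≡⟨ ∑-*-lap-green grounded b a ⟩
    Y b a                                ∎

module _ {N : ℕ} (es : EdgeList N) {Ω : Fin N → Fin N → ℚ} (resistance : IsResistance es Ω) (r : Fin N) where

  groundedGreen : Fin N → Fin N → ℚ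
  groundedGreen a k = proj₁ (resistance a r) k - proj₁ (resistance a r) r

  groundedGreen-isGreen : IsGreen es r groundedGreen
  groundedGreen-isGreen a k = begin
    lap es (groundedGreen a) k
      ≡⟨ lap-cong es (λ v → solve 2 (λ x c → x :- c := con 1ℚ :* x :+ con 0ℚ :* x :+ (:- c)) refl (x v) (x r)) k ⟩
    lap es (λ v → 1ℚ * x v + 0ℚ * x v + (- x r)) k  ≡⟨ lap-affine es 1ℚ 0ℚ (- x r) x x k ⟩
    1ℚ * lap es x k + 0ℚ * lap es x k               ≡⟨ solve 1 (λ l → con 1ℚ :* l :+ con 0ℚ :* l := l) refl (lap es x k) ⟩
    lap es x k                                      ≡⟨ proj₁ (proj₂ (resistance a r)) k ⟩
    unit a k - unit r k                             ∎
    where x = proj₁ (resistance a r)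

  groundedGreen-root : ∀ a → groundedGreen a r ≡ 0ℚ
  groundedGreen-root a = Qₚ.+-inverseʳ (proj₁ (resistance a r) r)

∑-lap-diagonal : ∀ {N} (es : EdgeList N) (F : Fin N → Fin N → ℚ) →
  ∑[ k < N ] lap es (F k) k ≡ ∑ₗ es (λ e → resistanceOf F (proj₁ e) (proj₂ e))
∑-lap-diagonal {N} []             F = sum-replicate-zero N
∑-lap-diagonal {N} ((u , v) ∷ es) F = begin
  ∑[ k < N ] (atU k + atV k + lap es (F k) k)
    ≡⟨ trans (∑-distrib-+ (λ k → atU k + atV k) (λ k → lap es (F k) k)) (cong (_+ _) (∑-distrib-+ atU atV)) ⟩
  ∑[ k < N ] atU k + ∑[ k < N ] atV k + ∑[ k < N ] lap es (F k) k
    ≡⟨ cong₂ _+_ (cong₂ _+_ (∑-when-≟ u (λ k → F k u - F k v)) (∑-when-≟ v (λ k → F k v - F k u))) (∑-lap-diagonal es F) ⟩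
  (F u u - F u v) + (F v v - F v u) + _
    ≡⟨ cong (_+ _) (solve 4 (λ uu uv vu vv → uu :- uv :+ (vv :- vu) := uu :- vu :- uv :+ vv) refl (F u u) (F u v) (F v u) (F v v)) ⟩
  resistanceOf F u v + ∑ₗ es (λ e → resistanceOf F (proj₁ e) (proj₂ e)) ∎
  where
  atU atV : Fin N → ℚ
  atU k = when (does (u Fin.≟ k)) (F k u - F k v)
  atV k = when (does (v Fin.≟ k)) (F k v - F k u)

foster : ∀ {N} (es : EdgeList N) r {Y} → IsGreen es r Y →
  ∑ₗ es (λ e → resistanceOf Y (proj₁ e) (proj₂ e)) ≡ ℕ→ℚ N - 1ℚ
foster {N} es r {Y} green = begin
  ∑ₗ es (λ e → resistanceOf Y (proj₁ e) (proj₂ e))  ≡⟨ ∑-lap-diagonal es Y ⟨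
  ∑[ k < N ] lap es (Y k) k                          ≡⟨ sum-cong-≗ (λ k → green k k) ⟩
  ∑[ k < N ] (unit k k - unit r k)                   ≡⟨ ∑-distrib-minus (λ k → unit k k) (unit r) ⟩
  ∑[ k < N ] unit k k - ∑[ k < N ] unit r k
    ≡⟨ cong₂ _-_ (sum-cong-≗ {N} (λ k → cong (λ d → when d 1ℚ) (dec-true (k Fin.≟ k) refl))) (∑-when-≟ r (λ _ → 1ℚ)) ⟩
  ∑[ k < N ] 1ℚ - 1ℚ                                 ≡⟨ cong (_- 1ℚ) (trans (∑-const N 1ℚ) (Qₚ.*-identityʳ (ℕ→ℚ N))) ⟩
  ℕ→ℚ N - 1ℚ                                         ∎

-- Degree-Kirchhoff indices through a Green function

∑< : ∀ N → (Fin N → Fin N → ℚ) → ℚ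
∑< N f = ∑[ i < N ] ∑[ j < N ] when (does (toℕ i ℕ.<? toℕ j)) (f i j)

∑<-cong : ∀ N {f g : Fin N → Fin N → ℚ} → (∀ a b → f a b ≡ g a b) → ∑< N f ≡ ∑< N g
∑<-cong N f≗g = sum-cong-≗ {N} (λ a → sum-cong-≗ {N} (λ b → cong (when _) (f≗g a b)))

sumPairs≡∑< : ∀ N f → sumPairs N f ≡ ∑< N f
sumPairs≡∑< N f = begin
  sumPairs N f                                ≡⟨ sumℚ≡∑ₗ (List.concatMap row (allFin N)) ⟩
  ∑ₗ (List.concatMap row (allFin N)) (λ x → x) ≡⟨ ∑ₗ-concatMap row (allFin N) (λ x → x) ⟩
  ∑ₗ (allFin N) (λ i → ∑ₗ (row i) (λ x → x))   ≡⟨ ∑ₗ-cong (allFin N) (λ i → trans (∑ₗ-map _ (allFin N) (λ x → x)) (∑ₗ-allFin N _)) ⟩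
  ∑ₗ (allFin N) (λ i → ∑[ j < N ] _)          ≡⟨ ∑ₗ-allFin N _ ⟩
  ∑< N f                                      ∎
  where
  row : Fin N → List ℚ
  row i = map (λ j → when (does (toℕ i ℕ.<? toℕ j)) (f i j)) (allFin N)

∑∑≡∑<+∑< : ∀ N (h : Fin N → Fin N → ℚ) → (∀ a b → h a b ≡ h b a) → (∀ a → h a a ≡ 0ℚ) →
  ∑[ a < N ] ∑[ b < N ] h a b ≡ ∑< N h + ∑< N h
∑∑≡∑<+∑< N h sym-h diag-h = begin
  ∑[ a < N ] ∑[ b < N ] h a b
    ≡⟨ sum-cong-≗ {N} (λ a → sum-cong-≗ {N} (λ b → split a b (toℕ a ℕ.<? toℕ b) (toℕ b ℕ.<? toℕ a))) ⟩
  ∑[ a < N ] ∑[ b < N ] (below a b + below b a)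
    ≡⟨ trans (sum-cong-≗ {N} (λ a → ∑-distrib-+ (below a) (λ b → below b a))) (∑-distrib-+ (λ a → ∑[ b < N ] below a b) (λ a → ∑[ b < N ] below b a)) ⟩
  ∑< N h + ∑[ a < N ] ∑[ b < N ] below b a
    ≡⟨ cong (∑< N h +_) (∑-comm (λ a b → below b a)) ⟩
  ∑< N h + ∑< N h ∎
  where
  below : Fin N → Fin N → ℚ
  below a b = when (does (toℕ a ℕ.<? toℕ b)) (h a b)
  split : ∀ a b (a<b? : Dec (toℕ a ℕ.< toℕ b)) (b<a? : Dec (toℕ b ℕ.< toℕ a)) →
    h a b ≡ when (does a<b?) (h a b) + when (does b<a?) (h b a)
  split a b (yes a<b) (yes b<a) = ⊥-elim (ℕₚ.<-asym a<b b<a)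
  split a b (yes _)   (no _)    = sym (Qₚ.+-identityʳ _)
  split a b (no _)    (yes _)   = trans (sym-h a b) (sym (Qₚ.+-identityˡ _))
  split a b (no a≮b)  (no b≮a)  = trans (cong (λ c → h c b) a≡b) (diag-h b)
    where a≡b = Finₚ.toℕ-injective (ℕₚ.≤-antisym (ℕₚ.≮⇒≥ b≮a) (ℕₚ.≮⇒≥ a≮b))

module _ {N : ℕ} where

  resistanceOf-sym : ∀ (Y : Fin N → Fin N → ℚ) a b → resistanceOf Y a b ≡ resistanceOf Y b a
  resistanceOf-sym Y a b =
    solve 4 (λ aa ba ab bb → aa :- ba :- ab :+ bb := bb :- ab :- ba :+ aa) refl (Y a a) (Y b a) (Y a b) (Y b b)

  resistanceOf-diag : ∀ (Y : Fin N → Fin N → ℚ) a → resistanceOf Y a a ≡ 0ℚ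
  resistanceOf-diag Y a = solve 1 (λ y → y :- y :- y :+ y := con 0ℚ) refl (Y a a)

  ∑<-+-weighted : ∀ (D : Fin N → ℕ) (Ω : Fin N → Fin N → ℚ) → (∀ a b → Ω a b ≡ Ω b a) → (∀ a → Ω a a ≡ 0ℚ) →
    ∑< N (λ a b → ℕ→ℚ (D a ℕ.+ D b) * Ω a b) ≡ ∑[ a < N ] ∑[ b < N ] (ℕ→ℚ (D a) * Ω a b)
  ∑<-+-weighted D Ω sym-Ω diag-Ω = p+p≡q+q⇒p≡q (∑< N h) (∑[ a < N ] ∑[ b < N ] f a b) (begin
    ∑< N h + ∑< N h                                 ≡⟨ ∑∑≡∑<+∑< N h sym-h diag-h ⟨
    ∑[ a < N ] ∑[ b < N ] h a b
      ≡⟨ sum-cong-≗ {N} (λ a → sum-cong-≗ {N} (λ b →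
           trans (cong (_* Ω a b) (ℕ→ℚ-+ (D a) (D b))) (Qₚ.*-distribʳ-+ (Ω a b) (ℕ→ℚ (D a)) (ℕ→ℚ (D b))))) ⟩
    ∑[ a < N ] ∑[ b < N ] (f a b + ℕ→ℚ (D b) * Ω a b)
      ≡⟨ trans (sum-cong-≗ {N} (λ a → ∑-distrib-+ (f a) (λ b → ℕ→ℚ (D b) * Ω a b)))
               (∑-distrib-+ (λ a → ∑[ b < N ] f a b) (λ a → ∑[ b < N ] (ℕ→ℚ (D b) * Ω a b))) ⟩
    ∑[ a < N ] ∑[ b < N ] f a b + ∑[ a < N ] ∑[ b < N ] (ℕ→ℚ (D b) * Ω a b)
      ≡⟨ cong (∑[ a < N ] ∑[ b < N ] f a b +_)
           (trans (∑-comm (λ a b → ℕ→ℚ (D b) * Ω a b)) (sum-cong-≗ {N} (λ b → sum-cong-≗ {N} (λ a → cong (ℕ→ℚ (D b) *_) (sym-Ω a b))))) ⟩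
    ∑[ a < N ] ∑[ b < N ] f a b + ∑[ a < N ] ∑[ b < N ] f a b ∎)
    where
    h f : Fin N → Fin N → ℚ
    h a b = ℕ→ℚ (D a ℕ.+ D b) * Ω a b
    f a b = ℕ→ℚ (D a) * Ω a b
    sym-h : ∀ a b → h a b ≡ h b a
    sym-h a b = cong₂ _*_ (cong ℕ→ℚ (ℕₚ.+-comm (D a) (D b))) (sym-Ω a b)
    diag-h : ∀ a → h a a ≡ 0ℚ
    diag-h a = trans (cong (ℕ→ℚ (D a ℕ.+ D a) *_) (diag-Ω a)) (Qₚ.*-zeroʳ (ℕ→ℚ (D a ℕ.+ D a)))

  ∑<-*-weighted : ∀ (D : Fin N → ℕ) (Ω : Fin N → Fin N → ℚ) → (∀ a b → Ω a b ≡ Ω b a) → (∀ a → Ω a a ≡ 0ℚ) →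
    ∑< N (λ a b → ℕ→ℚ (D a ℕ.* D b) * Ω a b) + ∑< N (λ a b → ℕ→ℚ (D a ℕ.* D b) * Ω a b)
      ≡ ∑[ a < N ] ∑[ b < N ] (ℕ→ℚ (D a) * ℕ→ℚ (D b) * Ω a b)
  ∑<-*-weighted D Ω sym-Ω diag-Ω = begin
    ∑< N h + ∑< N h                                 ≡⟨ ∑∑≡∑<+∑< N h sym-h diag-h ⟨
    ∑[ a < N ] ∑[ b < N ] h a b                     ≡⟨ sum-cong-≗ {N} (λ a → sum-cong-≗ {N} (λ b → cong (_* Ω a b) (ℕ→ℚ-* (D a) (D b)))) ⟩
    ∑[ a < N ] ∑[ b < N ] (ℕ→ℚ (D a) * ℕ→ℚ (D b) * Ω a b) ∎
    where
    h : Fin N → Fin N → ℚ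
    h a b = ℕ→ℚ (D a ℕ.* D b) * Ω a b
    sym-h : ∀ a b → h a b ≡ h b a
    sym-h a b = cong₂ _*_ (cong ℕ→ℚ (ℕₚ.*-comm (D a) (D b))) (sym-Ω a b)
    diag-h : ∀ a → h a a ≡ 0ℚ
    diag-h a = trans (cong (ℕ→ℚ (D a ℕ.* D a) *_) (diag-Ω a)) (Qₚ.*-zeroʳ (ℕ→ℚ (D a ℕ.* D a)))

  ∑-distrib-4 : ∀ (p q r s : Fin N → ℚ) →
    ∑[ k < N ] (p k - q k - r k + s k) ≡ sum p - sum q - sum r + sum s
  ∑-distrib-4 p q r s = trans (∑-distrib-+ (λ k → p k - q k - r k) s)
    (cong (_+ sum s) (trans (∑-distrib-minus (λ k → p k - q k) r) (cong (_- sum r) (∑-distrib-minus p q))))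

  ∑∑-*-resistanceOf : ∀ (W Y : Fin N → Fin N → ℚ) →
    ∑[ a < N ] ∑[ b < N ] (W a b * resistanceOf Y a b)
      ≡ ∑[ a < N ] ∑[ b < N ] (W a b * Y a a) - ∑[ a < N ] ∑[ b < N ] (W a b * Y b a)
        - ∑[ a < N ] ∑[ b < N ] (W a b * Y a b) + ∑[ a < N ] ∑[ b < N ] (W a b * Y b b)
  ∑∑-*-resistanceOf W Y = begin
    ∑[ a < N ] ∑[ b < N ] (W a b * resistanceOf Y a b)
      ≡⟨ sum-cong-≗ {N} (λ a → sum-cong-≗ {N} (λ b → solve 5 (λ w aa ba ab bb → w :* (aa :- ba :- ab :+ bb) := w :* aa :- w :* ba :- w :* ab :+ w :* bb)
           refl (W a b) (Y a a) (Y b a) (Y a b) (Y b b))) ⟩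
    ∑[ a < N ] ∑[ b < N ] (W a b * Y a a - W a b * Y b a - W a b * Y a b + W a b * Y b b)
      ≡⟨ sum-cong-≗ {N} (λ a → ∑-distrib-4 (λ b → W a b * Y a a) (λ b → W a b * Y b a) (λ b → W a b * Y a b) (λ b → W a b * Y b b)) ⟩
    ∑[ a < N ] (∑[ b < N ] (W a b * Y a a) - ∑[ b < N ] (W a b * Y b a) - ∑[ b < N ] (W a b * Y a b) + ∑[ b < N ] (W a b * Y b b))
      ≡⟨ ∑-distrib-4 _ _ _ _ ⟩
    _ ∎

  ∑∑-const : ∀ (f : Fin N → ℚ) → ∑[ a < N ] ∑[ b < N ] f a ≡ ℕ→ℚ N * sum f
  ∑∑-const f = trans (sum-cong-≗ {N} (λ a → ∑-const N (f a))) (sym (*-distribˡ-sum (ℕ→ℚ N) f))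

  ∑∑-product : ∀ (f g : Fin N → ℚ) → ∑[ a < N ] ∑[ b < N ] (f a * g b) ≡ sum f * sum g
  ∑∑-product f g = trans (sum-cong-≗ {N} (λ a → sym (*-distribˡ-sum (f a) g))) (sym (*-distribʳ-sum (sum g) f))

degℚ : ∀ {N} → EdgeList N → Fin N → ℚ
degℚ es a = ℕ→ℚ (deg es a)

module _ {N : ℕ} (es : EdgeList N) {Ω Y : Fin N → Fin N → ℚ}
         (Ω≡ : ∀ a b → Ω a b ≡ resistanceOf Y a b) (sym-Y : ∀ a b → Y a b ≡ Y b a) where

  Rplus-green : Rplus es Ω ≡ ℕ→ℚ N * ∑[ a < N ] (degℚ es a * Y a a)
    - ∑[ a < N ] ∑[ b < N ] (degℚ es a * Y a b) - ∑[ a < N ] ∑[ b < N ] (degℚ es a * Y a b)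
    + sum (degℚ es) * ∑[ a < N ] Y a a
  Rplus-green = begin
    Rplus es Ω                                      ≡⟨ sumPairs≡∑< N _ ⟩
    ∑< N (λ a b → ℕ→ℚ (deg es a ℕ.+ deg es b) * Ω a b)
      ≡⟨ ∑<-cong N (λ a b → cong (ℕ→ℚ (deg es a ℕ.+ deg es b) *_) (Ω≡ a b)) ⟩
    ∑< N (λ a b → ℕ→ℚ (deg es a ℕ.+ deg es b) * resistanceOf Y a b)
      ≡⟨ ∑<-+-weighted (deg es) (resistanceOf Y) (resistanceOf-sym Y) (resistanceOf-diag Y) ⟩
    ∑[ a < N ] ∑[ b < N ] (degℚ es a * resistanceOf Y a b)
      ≡⟨ ∑∑-*-resistanceOf (λ a b → degℚ es a) Y ⟩
    ∑[ a < N ] ∑[ b < N ] (degℚ es a * Y a a) - ∑[ a < N ] ∑[ b < N ] (degℚ es a * Y b a)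
      - P + ∑[ a < N ] ∑[ b < N ] (degℚ es a * Y b b)
      ≡⟨ cong₂ (λ s t → s - t - P + ∑[ a < N ] ∑[ b < N ] (degℚ es a * Y b b)) (∑∑-const (λ a → degℚ es a * Y a a))
           (sum-cong-≗ {N} (λ a → sum-cong-≗ {N} (λ b → cong (degℚ es a *_) (sym-Y b a)))) ⟩
    ℕ→ℚ N * ∑[ a < N ] (degℚ es a * Y a a) - P - P + ∑[ a < N ] ∑[ b < N ] (degℚ es a * Y b b)
      ≡⟨ cong (ℕ→ℚ N * ∑[ a < N ] (degℚ es a * Y a a) - P - P +_) (∑∑-product (degℚ es) (λ b → Y b b)) ⟩
    ℕ→ℚ N * ∑[ a < N ] (degℚ es a * Y a a) - P - P + sum (degℚ es) * ∑[ a < N ] Y a a ∎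
    where P = ∑[ a < N ] ∑[ b < N ] (degℚ es a * Y a b)

  Rstar-green : Rstar es Ω + Rstar es Ω ≡ sum (degℚ es) * ∑[ a < N ] (degℚ es a * Y a a)
    - ∑[ a < N ] ∑[ b < N ] (degℚ es a * degℚ es b * Y a b) - ∑[ a < N ] ∑[ b < N ] (degℚ es a * degℚ es b * Y a b)
    + sum (degℚ es) * ∑[ a < N ] (degℚ es a * Y a a)
  Rstar-green = begin
    Rstar es Ω + Rstar es Ω                         ≡⟨ cong₂ _+_ (sumPairs≡∑< N _) (sumPairs≡∑< N _) ⟩
    ∑< N h + ∑< N h                                 ≡⟨ cong₂ _+_ (∑<-cong N h≡) (∑<-cong N h≡) ⟩
    ∑< N h′ + ∑< N h′                               ≡⟨ ∑<-*-weighted (deg es) (resistanceOf Y) (resistanceOf-sym Y) (resistanceOf-diag Y) ⟩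
    ∑[ a < N ] ∑[ b < N ] (d a * d b * resistanceOf Y a b)
      ≡⟨ ∑∑-*-resistanceOf (λ a b → d a * d b) Y ⟩
    ∑[ a < N ] ∑[ b < N ] (d a * d b * Y a a) - ∑[ a < N ] ∑[ b < N ] (d a * d b * Y b a)
      - P + ∑[ a < N ] ∑[ b < N ] (d a * d b * Y b b)
      ≡⟨ cong₂ (λ s t → s - t - P + ∑[ a < N ] ∑[ b < N ] (d a * d b * Y b b))
           (trans (sum-cong-≗ {N} (λ a → sum-cong-≗ {N} (λ b → solve 3 (λ x y z → x :* y :* z := x :* z :* y) refl (d a) (d b) (Y a a))))
                  (trans (∑∑-product (λ a → d a * Y a a) d) (Qₚ.*-comm (∑[ a < N ] (d a * Y a a)) (sum d))))
           (sum-cong-≗ {N} (λ a → sum-cong-≗ {N} (λ b → cong (d a * d b *_) (sym-Y b a)))) ⟩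
    sum d * ∑[ a < N ] (d a * Y a a) - P - P + ∑[ a < N ] ∑[ b < N ] (d a * d b * Y b b)
      ≡⟨ cong (sum d * ∑[ a < N ] (d a * Y a a) - P - P +_)
           (trans (sum-cong-≗ {N} (λ a → sum-cong-≗ {N} (λ b → Qₚ.*-assoc (d a) (d b) (Y b b))))
                  (∑∑-product d (λ b → d b * Y b b))) ⟩
    sum d * ∑[ a < N ] (d a * Y a a) - P - P + sum d * ∑[ a < N ] (d a * Y a a) ∎
    where
    d = degℚ es
    P = ∑[ a < N ] ∑[ b < N ] (d a * d b * Y a b)
    h h′ : Fin N → Fin N → ℚ
    h a b = ℕ→ℚ (deg es a ℕ.* deg es b) * Ω a b
    h′ a b = ℕ→ℚ (deg es a ℕ.* deg es b) * resistanceOf Y a b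
    h≡ : ∀ a b → h a b ≡ h′ a b
    h≡ a b = cong (ℕ→ℚ (deg es a ℕ.* deg es b) *_) (Ω≡ a b)

-- The triangulation

data ↑-View (n m : ℕ) : Fin (n ℕ.+ m) → Set where
  inˡ : ∀ i → ↑-View n m (i ↑ˡ m)
  inʳ : ∀ k → ↑-View n m (n ↑ʳ k)

↑-view : ∀ n m v → ↑-View n m v
↑-view zero    m v       = inʳ v
↑-view (suc n) m zero    = inˡ zero
↑-view (suc n) m (suc v) with ↑-view n m v
... | inˡ i = inˡ (suc i)
... | inʳ k = inʳ k

does-≟-sym : ∀ {N} (a b : Fin N) → does (a Fin.≟ b) ≡ does (b Fin.≟ a)
does-≟-sym a b with a Fin.≟ b
... | yes a≡b = sym (dec-true (b Fin.≟ a) (sym a≡b))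
... | no a≢b  = sym (dec-false (b Fin.≟ a) (a≢b ∘ sym))

does-≟-injective : ∀ {N M} (f : Fin N → Fin M) → (∀ {a b} → f a ≡ f b → a ≡ b) →
  ∀ a b → does (f a Fin.≟ f b) ≡ does (a Fin.≟ b)
does-≟-injective f f-injective a b with a Fin.≟ b
... | yes refl = dec-true (f a Fin.≟ f a) refl
... | no a≢b   = dec-false (f a Fin.≟ f b) (a≢b ∘ f-injective)

module _ {n m : ℕ} where

  does-↑ˡ : ∀ (a b : Fin n) → does ((a ↑ˡ m) Fin.≟ (b ↑ˡ m)) ≡ does (a Fin.≟ b)
  does-↑ˡ = does-≟-injective (_↑ˡ m) (Finₚ.↑ˡ-injective m _ _)

  does-↑ʳ : ∀ (a b : Fin m) → does ((n ↑ʳ a) Fin.≟ (n ↑ʳ b)) ≡ does (a Fin.≟ b)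
  does-↑ʳ = does-≟-injective (n ↑ʳ_) (Finₚ.↑ʳ-injective n _ _)

  ↑ˡ≢↑ʳ : ∀ (a : Fin n) (k : Fin m) → a ↑ˡ m ≢ n ↑ʳ k
  ↑ˡ≢↑ʳ a k eq = ℕₚ.<-irrefl refl (ℕₚ.<-≤-trans
    (subst (ℕ._< n) (sym (Finₚ.toℕ-↑ˡ a m)) (Finₚ.toℕ<n a))
    (subst (n ℕ.≤_) (trans (sym (Finₚ.toℕ-↑ʳ n k)) (cong toℕ (sym eq))) (ℕₚ.m≤m+n n (toℕ k))))

  does-↑ˡ↑ʳ : ∀ (a : Fin n) (k : Fin m) → does ((a ↑ˡ m) Fin.≟ (n ↑ʳ k)) ≡ false
  does-↑ˡ↑ʳ a k = dec-false ((a ↑ˡ m) Fin.≟ (n ↑ʳ k)) (↑ˡ≢↑ʳ a k)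

  does-↑ʳ↑ˡ : ∀ (a : Fin n) (k : Fin m) → does ((n ↑ʳ k) Fin.≟ (a ↑ˡ m)) ≡ false
  does-↑ʳ↑ˡ a k = dec-false ((n ↑ʳ k) Fin.≟ (a ↑ˡ m)) (↑ˡ≢↑ʳ a k ∘ sym)

  unit-↑ˡ : ∀ (a b : Fin n) → unit (a ↑ˡ m) (b ↑ˡ m) ≡ unit a b
  unit-↑ˡ a b = cong (λ d → when d 1ℚ) (does-↑ˡ a b)

  unit-↑ʳ : ∀ (a b : Fin m) → unit (n ↑ʳ a) (n ↑ʳ b) ≡ unit a b
  unit-↑ʳ a b = cong (λ d → when d 1ℚ) (does-↑ʳ a b)

  unit-↑ˡ↑ʳ : ∀ (a : Fin n) (k : Fin m) → unit (a ↑ˡ m) (n ↑ʳ k) ≡ 0ℚ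
  unit-↑ˡ↑ʳ a k = cong (λ d → when d 1ℚ) (does-↑ˡ↑ʳ a k)

  unit-↑ʳ↑ˡ : ∀ (a : Fin n) (k : Fin m) → unit (n ↑ʳ k) (a ↑ˡ m) ≡ 0ℚ
  unit-↑ʳ↑ˡ a k = cong (λ d → when d 1ℚ) (does-↑ʳ↑ˡ a k)

lapEdge : ∀ {N} → Fin N × Fin N → (Fin N → ℚ) → Fin N → ℚ
lapEdge (u , v) x k = when (does (u Fin.≟ k)) (x u - x v) + when (does (v Fin.≟ k)) (x v - x u)

degEdge : ∀ {N} → Fin N × Fin N → Fin N → ℚ
degEdge (u , v) k = when (does (u Fin.≟ k)) 1ℚ + when (does (v Fin.≟ k)) 1ℚ

lap≡∑ₗ-lapEdge : ∀ {N} (es : EdgeList N) x k → lap es x k ≡ ∑ₗ es (λ e → lapEdge e x k)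
lap≡∑ₗ-lapEdge []             x k = refl
lap≡∑ₗ-lapEdge ((u , v) ∷ es) x k = cong (lapEdge (u , v) x k +_) (lap≡∑ₗ-lapEdge es x k)

degℚ≡∑ₗ-degEdge : ∀ {N} (es : EdgeList N) k → degℚ es k ≡ ∑ₗ es (λ e → degEdge e k)
degℚ≡∑ₗ-degEdge []             k = refl
degℚ≡∑ₗ-degEdge ((u , v) ∷ es) k = begin
  ℕ→ℚ (indicator u ℕ.+ indicator v ℕ.+ deg es k)
    ≡⟨ trans (ℕ→ℚ-+ (indicator u ℕ.+ indicator v) (deg es k)) (cong (_+ degℚ es k) (ℕ→ℚ-+ (indicator u) (indicator v))) ⟩
  ℕ→ℚ (indicator u) + ℕ→ℚ (indicator v) + degℚ es k
    ≡⟨ cong₂ _+_ (cong₂ _+_ (cast (does (u Fin.≟ k))) (cast (does (v Fin.≟ k)))) (degℚ≡∑ₗ-degEdge es k) ⟩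
  degEdge (u , v) k + ∑ₗ es (λ e → degEdge e k) ∎
  where
  indicator : _ → ℕ
  indicator w = if does (w Fin.≟ k) then 1 else 0
  cast : ∀ b → ℕ→ℚ (if b then 1 else 0) ≡ when b 1ℚ
  cast true  = refl
  cast false = refl

Adjacent-++ʳ : ∀ {N} (es : EdgeList N) {es′ a b} → Adjacent es′ a b → Adjacent (es ++ es′) a b
Adjacent-++ʳ []       adj = adj
Adjacent-++ʳ (e ∷ es) adj = there (Adjacent-++ʳ es adj)

Adjacent-sym : ∀ {N} {es : EdgeList N} {a b} → Adjacent es a b → Adjacent es b a
Adjacent-sym here-uv     = here-vu
Adjacent-sym here-vu     = here-uv
Adjacent-sym (there adj) = there (Adjacent-sym adj)

Reachable-trans : ∀ {N} {es : EdgeList N} {a b c} → Reachable es a b → Reachable es b c → Reachable es a c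
Reachable-trans refl-r          q = q
Reachable-trans (step adj path) q = step adj (Reachable-trans path q)

Reachable-sym : ∀ {N} {es : EdgeList N} {a b} → Reachable es a b → Reachable es b a
Reachable-sym refl-r          = refl-r
Reachable-sym (step adj path) = Reachable-trans (Reachable-sym path) (step (Adjacent-sym adj) refl-r)

-- The three edges uv, uw, vw of a triangle contribute triangleLap to lap at a vertex z,
-- where d₁, d₂, d₃ record whether z is u, v, w; likewise triangleDeg to its degree.
triangleLap : Bool → Bool → Bool → ℚ → ℚ → ℚ → ℚ
triangleLap d₁ d₂ d₃ y₁ y₂ y₃ =
  (when d₁ (y₁ - y₂) + when d₂ (y₂ - y₁))
  + ((when d₁ (y₁ - y₃) + when d₃ (y₃ - y₁)) + ((when d₂ (y₂ - y₃) + when d₃ (y₃ - y₂)) + 0ℚ))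

triangleDeg : Bool → Bool → Bool → ℚ
triangleDeg d₁ d₂ d₃ = (when d₁ 1ℚ + when d₂ 1ℚ) + ((when d₁ 1ℚ + when d₃ 1ℚ) + ((when d₂ 1ℚ + when d₃ 1ℚ) + 0ℚ))

-- At an endpoint of uv the triangle u v w with potentials ⅔x_u, ⅔x_v, ⅓(x_u + x_v) + δ at w
-- acts like the edge uv under x, up to a loss δ.
triangleLap-endpoint : ∀ d₁ d₂ x₁ x₂ δ →
  triangleLap d₁ d₂ false (⅔ * x₁) (⅔ * x₂) (⅓ * (x₁ + x₂) + δ)
    ≡ (when d₁ (x₁ - x₂) + when d₂ (x₂ - x₁)) - δ * (when d₁ 1ℚ + when d₂ 1ℚ)
triangleLap-endpoint true  true  = solve 3 (λ x₁ x₂ δ →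
  (con ⅔ :* x₁ :- con ⅔ :* x₂ :+ (con ⅔ :* x₂ :- con ⅔ :* x₁))
  :+ ((con ⅔ :* x₁ :- (con ⅓ :* (x₁ :+ x₂) :+ δ) :+ con 0ℚ) :+ ((con ⅔ :* x₂ :- (con ⅓ :* (x₁ :+ x₂) :+ δ) :+ con 0ℚ) :+ con 0ℚ))
  := (x₁ :- x₂ :+ (x₂ :- x₁)) :- δ :* (con 1ℚ :+ con 1ℚ)) refl
triangleLap-endpoint true  false = solve 3 (λ x₁ x₂ δ →
  (con ⅔ :* x₁ :- con ⅔ :* x₂ :+ con 0ℚ)
  :+ ((con ⅔ :* x₁ :- (con ⅓ :* (x₁ :+ x₂) :+ δ) :+ con 0ℚ) :+ ((con 0ℚ :+ con 0ℚ) :+ con 0ℚ))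
  := (x₁ :- x₂ :+ con 0ℚ) :- δ :* (con 1ℚ :+ con 0ℚ)) refl
triangleLap-endpoint false true  = solve 3 (λ x₁ x₂ δ →
  (con 0ℚ :+ (con ⅔ :* x₂ :- con ⅔ :* x₁))
  :+ ((con 0ℚ :+ con 0ℚ) :+ ((con ⅔ :* x₂ :- (con ⅓ :* (x₁ :+ x₂) :+ δ) :+ con 0ℚ) :+ con 0ℚ))
  := (con 0ℚ :+ (x₂ :- x₁)) :- δ :* (con 0ℚ :+ con 1ℚ)) refl
triangleLap-endpoint false false = solve 3 (λ x₁ x₂ δ →
  (con 0ℚ :+ con 0ℚ) :+ ((con 0ℚ :+ con 0ℚ) :+ ((con 0ℚ :+ con 0ℚ) :+ con 0ℚ))
  := (con 0ℚ :+ con 0ℚ) :- δ :* (con 0ℚ :+ con 0ℚ)) refl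

triangleLap-apex : ∀ d y₁ y₂ y₃ → triangleLap false false d y₁ y₂ y₃ ≡ when d ((y₃ - y₁) + (y₃ - y₂))
triangleLap-apex true  = solve 3 (λ y₁ y₂ y₃ →
  (con 0ℚ :+ con 0ℚ) :+ ((con 0ℚ :+ (y₃ :- y₁)) :+ ((con 0ℚ :+ (y₃ :- y₂)) :+ con 0ℚ)) := (y₃ :- y₁) :+ (y₃ :- y₂)) refl
triangleLap-apex false = solve 3 (λ y₁ y₂ y₃ →
  (con 0ℚ :+ con 0ℚ) :+ ((con 0ℚ :+ con 0ℚ) :+ ((con 0ℚ :+ con 0ℚ) :+ con 0ℚ)) := con 0ℚ) refl

triangleDeg-endpoint : ∀ d₁ d₂ → triangleDeg d₁ d₂ false ≡ ℕ→ℚ 2 * (when d₁ 1ℚ + when d₂ 1ℚ)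
triangleDeg-endpoint true  true  = refl
triangleDeg-endpoint true  false = refl
triangleDeg-endpoint false true  = refl
triangleDeg-endpoint false false = refl

triangleDeg-apex : ∀ d → triangleDeg false false d ≡ when d (ℕ→ℚ 2)
triangleDeg-apex true  = refl
triangleDeg-apex false = refl

module Triangulation {n : ℕ} (es : EdgeList n) where

  m N : ℕ
  m = length es
  N = n ℕ.+ m

  tri : EdgeList N
  tri = triEdges es

  end₁ end₂ : Fin m → Fin n
  end₁ k = proj₁ (lookup es k)
  end₂ k = proj₂ (lookup es k)

  liftEdge : Fin n × Fin n → Fin N × Fin N
  liftEdge (a , b) = (a ↑ˡ m) , (b ↑ˡ m)

  spokes : Fin m → EdgeList N
  spokes k = ((end₁ k ↑ˡ m) , n ↑ʳ k) ∷ ((end₂ k ↑ˡ m) , n ↑ʳ k) ∷ []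

  ∑ₗ-tri : ∀ (F : Fin N × Fin N → ℚ) →
    ∑ₗ tri F ≡ ∑[ k < m ] (F (liftEdge (lookup es k)) + ∑ₗ (spokes k) F)
  ∑ₗ-tri F = begin
    ∑ₗ tri F
      ≡⟨ ∑ₗ-++ (map liftEdge es) (concatMap spokes (allFin m)) F ⟩
    ∑ₗ (map liftEdge es) F + ∑ₗ (concatMap spokes (allFin m)) F
      ≡⟨ cong₂ _+_ (∑ₗ-map liftEdge es F) (∑ₗ-concatMap spokes (allFin m) F) ⟩
    ∑ₗ es (F ∘ liftEdge) + ∑ₗ (allFin m) (λ k → ∑ₗ (spokes k) F)
      ≡⟨ cong₂ _+_ (sym (∑ₗ-lookup es (F ∘ liftEdge))) (∑ₗ-allFin m _) ⟩
    ∑[ k < m ] F (liftEdge (lookup es k)) + ∑[ k < m ] ∑ₗ (spokes k) F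
      ≡⟨ ∑-distrib-+ (λ k → F (liftEdge (lookup es k))) (λ k → ∑ₗ (spokes k) F) ⟨
    ∑[ k < m ] (F (liftEdge (lookup es k)) + ∑ₗ (spokes k) F) ∎

  lapEdge-sum : ∀ x i → lap es x i ≡ ∑[ k < m ] lapEdge (lookup es k) x i
  lapEdge-sum x i = trans (lap≡∑ₗ-lapEdge es x i) (sym (∑ₗ-lookup es (λ e → lapEdge e x i)))

  degEdge-sum : ∀ i → degℚ es i ≡ ∑[ k < m ] degEdge (lookup es k) i
  degEdge-sum i = trans (degℚ≡∑ₗ-degEdge es i) (sym (∑ₗ-lookup es (λ e → degEdge e i)))

  extend : (Fin n → ℚ) → (Fin m → ℚ) → Fin N → ℚ
  extend x δ a = [ (λ i → ⅔ * x i) , (λ k → ⅓ * (x (end₁ k) + x (end₂ k)) + δ k) ]′ (splitAt n a)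

  extend-old : ∀ x δ i → extend x δ (i ↑ˡ m) ≡ ⅔ * x i
  extend-old x δ i = cong [ (λ i → ⅔ * x i) , (λ k → ⅓ * (x (end₁ k) + x (end₂ k)) + δ k) ]′ (Finₚ.splitAt-↑ˡ n i m)

  extend-new : ∀ x δ k → extend x δ (n ↑ʳ k) ≡ ⅓ * (x (end₁ k) + x (end₂ k)) + δ k
  extend-new x δ k = cong [ (λ i → ⅔ * x i) , (λ k → ⅓ * (x (end₁ k) + x (end₂ k)) + δ k) ]′ (Finₚ.splitAt-↑ʳ n m k)

  lapTriangle-at-old : ∀ x δ i k →
    lapEdge (liftEdge (lookup es k)) (extend x δ) (i ↑ˡ m) + ∑ₗ (spokes k) (λ e → lapEdge e (extend x δ) (i ↑ˡ m))
      ≡ lapEdge (lookup es k) x i - δ k * degEdge (lookup es k) i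
  lapTriangle-at-old x δ i k
    rewrite does-↑ˡ {n} {m} (end₁ k) i | does-↑ˡ {n} {m} (end₂ k) i | does-↑ʳ↑ˡ {n} {m} i k
          | extend-old x δ (end₁ k) | extend-old x δ (end₂ k) | extend-new x δ k
    = triangleLap-endpoint (does (end₁ k Fin.≟ i)) (does (end₂ k Fin.≟ i)) (x (end₁ k)) (x (end₂ k)) (δ k)

  lapTriangle-at-new : ∀ y j k →
    lapEdge (liftEdge (lookup es k)) y (n ↑ʳ j) + ∑ₗ (spokes k) (λ e → lapEdge e y (n ↑ʳ j))
      ≡ when (does (j Fin.≟ k)) ((y (n ↑ʳ k) - y (end₁ k ↑ˡ m)) + (y (n ↑ʳ k) - y (end₂ k ↑ˡ m)))
  lapTriangle-at-new y j k
    rewrite does-↑ˡ↑ʳ {n} {m} (end₁ k) j | does-↑ˡ↑ʳ {n} {m} (end₂ k) j | does-↑ʳ {n} {m} k j | does-≟-sym k j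
    = triangleLap-apex (does (j Fin.≟ k)) (y (end₁ k ↑ˡ m)) (y (end₂ k ↑ˡ m)) (y (n ↑ʳ k))

  degTriangle-at-old : ∀ i k →
    degEdge (liftEdge (lookup es k)) (i ↑ˡ m) + ∑ₗ (spokes k) (λ e → degEdge e (i ↑ˡ m)) ≡ ℕ→ℚ 2 * degEdge (lookup es k) i
  degTriangle-at-old i k rewrite does-↑ˡ {n} {m} (end₁ k) i | does-↑ˡ {n} {m} (end₂ k) i | does-↑ʳ↑ˡ {n} {m} i k
    = triangleDeg-endpoint (does (end₁ k Fin.≟ i)) (does (end₂ k Fin.≟ i))

  degTriangle-at-new : ∀ j k →
    degEdge (liftEdge (lookup es k)) (n ↑ʳ j) + ∑ₗ (spokes k) (λ e → degEdge e (n ↑ʳ j)) ≡ when (does (j Fin.≟ k)) (ℕ→ℚ 2)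
  degTriangle-at-new j k
    rewrite does-↑ˡ↑ʳ {n} {m} (end₁ k) j | does-↑ˡ↑ʳ {n} {m} (end₂ k) j | does-↑ʳ {n} {m} k j | does-≟-sym k j
    = triangleDeg-apex (does (j Fin.≟ k))

  lap-extend-old : ∀ x δ i → lap tri (extend x δ) (i ↑ˡ m) ≡ lap es x i - ∑[ k < m ] (δ k * degEdge (lookup es k) i)
  lap-extend-old x δ i = begin
    lap tri (extend x δ) (i ↑ˡ m)
      ≡⟨ trans (lap≡∑ₗ-lapEdge tri (extend x δ) (i ↑ˡ m)) (∑ₗ-tri (λ e → lapEdge e (extend x δ) (i ↑ˡ m))) ⟩
    ∑[ k < m ] (lapEdge (liftEdge (lookup es k)) (extend x δ) (i ↑ˡ m) + ∑ₗ (spokes k) (λ e → lapEdge e (extend x δ) (i ↑ˡ m)))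
      ≡⟨ sum-cong-≗ {m} (lapTriangle-at-old x δ i) ⟩
    ∑[ k < m ] (lapEdge (lookup es k) x i - δ k * degEdge (lookup es k) i)
      ≡⟨ ∑-distrib-minus (λ k → lapEdge (lookup es k) x i) (λ k → δ k * degEdge (lookup es k) i) ⟩
    ∑[ k < m ] lapEdge (lookup es k) x i - ∑[ k < m ] (δ k * degEdge (lookup es k) i)
      ≡⟨ cong (_- ∑[ k < m ] (δ k * degEdge (lookup es k) i)) (lapEdge-sum x i) ⟨
    lap es x i - ∑[ k < m ] (δ k * degEdge (lookup es k) i) ∎

  lap-extend-new : ∀ x δ j → lap tri (extend x δ) (n ↑ʳ j) ≡ δ j + δ j
  lap-extend-new x δ j = begin
    lap tri y (n ↑ʳ j)
      ≡⟨ trans (lap≡∑ₗ-lapEdge tri y (n ↑ʳ j)) (∑ₗ-tri (λ e → lapEdge e y (n ↑ʳ j))) ⟩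
    ∑[ k < m ] (lapEdge (liftEdge (lookup es k)) y (n ↑ʳ j) + ∑ₗ (spokes k) (λ e → lapEdge e y (n ↑ʳ j)))
      ≡⟨ trans (sum-cong-≗ {m} (lapTriangle-at-new y j)) (∑-when-≟ j (λ k → (y (n ↑ʳ k) - y (end₁ k ↑ˡ m)) + (y (n ↑ʳ k) - y (end₂ k ↑ˡ m)))) ⟩
    (y (n ↑ʳ j) - y (end₁ j ↑ˡ m)) + (y (n ↑ʳ j) - y (end₂ j ↑ˡ m))
      ≡⟨ cong₂ (λ w p → (w - p) + (w - y (end₂ j ↑ˡ m))) (extend-new x δ j) (extend-old x δ (end₁ j)) ⟩
    (w - ⅔ * x (end₁ j)) + (w - y (end₂ j ↑ˡ m))
      ≡⟨ cong (λ p → (w - ⅔ * x (end₁ j)) + (w - p)) (extend-old x δ (end₂ j)) ⟩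
    (w - ⅔ * x (end₁ j)) + (w - ⅔ * x (end₂ j))
      ≡⟨ solve 3 (λ a b d → (con ⅓ :* (a :+ b) :+ d :- con ⅔ :* a) :+ (con ⅓ :* (a :+ b) :+ d :- con ⅔ :* b) := d :+ d)
           refl (x (end₁ j)) (x (end₂ j)) (δ j) ⟩
    δ j + δ j ∎
    where
    y = extend x δ
    w = ⅓ * (x (end₁ j) + x (end₂ j)) + δ j

  deg-old : ∀ i → degℚ tri (i ↑ˡ m) ≡ ℕ→ℚ 2 * degℚ es i
  deg-old i = begin
    degℚ tri (i ↑ˡ m)
      ≡⟨ trans (degℚ≡∑ₗ-degEdge tri (i ↑ˡ m)) (∑ₗ-tri (λ e → degEdge e (i ↑ˡ m))) ⟩
    ∑[ k < m ] (degEdge (liftEdge (lookup es k)) (i ↑ˡ m) + ∑ₗ (spokes k) (λ e → degEdge e (i ↑ˡ m)))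
      ≡⟨ sum-cong-≗ {m} (degTriangle-at-old i) ⟩
    ∑[ k < m ] (ℕ→ℚ 2 * degEdge (lookup es k) i)
      ≡⟨ *-distribˡ-sum (ℕ→ℚ 2) (λ k → degEdge (lookup es k) i) ⟨
    ℕ→ℚ 2 * ∑[ k < m ] degEdge (lookup es k) i
      ≡⟨ cong (ℕ→ℚ 2 *_) (degEdge-sum i) ⟨
    ℕ→ℚ 2 * degℚ es i ∎

  deg-new : ∀ j → degℚ tri (n ↑ʳ j) ≡ ℕ→ℚ 2
  deg-new j = begin
    degℚ tri (n ↑ʳ j)
      ≡⟨ trans (degℚ≡∑ₗ-degEdge tri (n ↑ʳ j)) (∑ₗ-tri (λ e → degEdge e (n ↑ʳ j))) ⟩
    ∑[ k < m ] (degEdge (liftEdge (lookup es k)) (n ↑ʳ j) + ∑ₗ (spokes k) (λ e → degEdge e (n ↑ʳ j)))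
      ≡⟨ trans (sum-cong-≗ {m} (degTriangle-at-new j)) (∑-when-≟ j (λ _ → ℕ→ℚ 2)) ⟩
    ℕ→ℚ 2 ∎

  old-adjacent : ∀ (rest : EdgeList N) {es′ : EdgeList n} {a b} → Adjacent es′ a b →
    Adjacent (map liftEdge es′ ++ rest) (a ↑ˡ m) (b ↑ˡ m)
  old-adjacent rest here-uv     = here-uv
  old-adjacent rest here-vu     = here-vu
  old-adjacent rest (there adj) = there (old-adjacent rest adj)

  old-reachable : ∀ {a b} → Reachable es a b → Reachable tri (a ↑ˡ m) (b ↑ˡ m)
  old-reachable refl-r          = refl-r
  old-reachable (step adj path) = step (old-adjacent (concatMap spokes (allFin m)) adj) (old-reachable path)

  spoke-adjacent : ∀ (ks : List (Fin m)) {k} → k ∈ ks → Adjacent (concatMap spokes ks) (n ↑ʳ k) (end₁ k ↑ˡ m)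
  spoke-adjacent (k ∷ ks) (here refl) = here-vu
  spoke-adjacent (_ ∷ ks) (there k∈ks) = there (there (spoke-adjacent ks k∈ks))

  reaches-old : ∀ a → ∃ λ i → Reachable tri a (i ↑ˡ m)
  reaches-old a with ↑-view n m a
  ... | inˡ i = i , refl-r
  ... | inʳ k = end₁ k , step (Adjacent-++ʳ (map liftEdge es) (spoke-adjacent (allFin m) (∈-allFin k))) refl-r

  tri-connected : Connected es → Connected tri
  tri-connected connected a b with reaches-old a | reaches-old b
  ... | i , a→i | j , b→j = Reachable-trans a→i (Reachable-trans (old-reachable (connected i j)) (Reachable-sym b→j))

  module Green {Ω : Fin n → Fin n → ℚ} (resistance : IsResistance es Ω) (r : Fin n) where

    M : Fin n → Fin n → ℚ
    M = groundedGreen es resistance r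

    M-root : ∀ a → M a r ≡ 0ℚ
    M-root = groundedGreen-root es resistance r

    M-isGreen : IsGreen es r M
    M-isGreen = groundedGreen-isGreen es resistance r

    -- A unit current entering at the apex w_e leaves it equally through the two endpoints of e.
    midGreen : Fin m → Fin n → ℚ
    midGreen e t = ½ * M (end₁ e) t + ½ * M (end₂ e) t + 0ℚ

    kick : Fin m → Fin m → ℚ
    kick e k = when (does (e Fin.≟ k)) ½

    triGreen : Fin N → Fin N → ℚ
    triGreen a = [ (λ i → extend (M i) (λ _ → 0ℚ)) , (λ e → extend (midGreen e) (kick e)) ]′ (splitAt n a)

    triGreen-old : ∀ i → triGreen (i ↑ˡ m) ≡ extend (M i) (λ _ → 0ℚ)
    triGreen-old i = cong [ (λ i → extend (M i) (λ _ → 0ℚ)) , (λ e → extend (midGreen e) (kick e)) ]′ (Finₚ.splitAt-↑ˡ n i m)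

    triGreen-new : ∀ e → triGreen (n ↑ʳ e) ≡ extend (midGreen e) (kick e)
    triGreen-new e = cong [ (λ i → extend (M i) (λ _ → 0ℚ)) , (λ e → extend (midGreen e) (kick e)) ]′ (Finₚ.splitAt-↑ʳ n m e)

    old-source : ∀ i → IsPotential tri (i ↑ˡ m) (r ↑ˡ m) (extend (M i) (λ _ → 0ℚ))
    old-source i a with ↑-view n m a
    ... | inˡ j = begin
      lap tri (extend (M i) (λ _ → 0ℚ)) (j ↑ˡ m)
        ≡⟨ lap-extend-old (M i) (λ _ → 0ℚ) j ⟩
      lap es (M i) j - ∑[ k < m ] (0ℚ * degEdge (lookup es k) j)
        ≡⟨ cong₂ _-_ (M-isGreen i j)
             (trans (sum-cong-≗ {m} (λ k → Qₚ.*-zeroˡ (degEdge (lookup es k) j))) (sum-replicate-zero m)) ⟩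
      unit i j - unit r j - 0ℚ
        ≡⟨ solve 2 (λ p q → p :- q :- con 0ℚ := p :- q) refl (unit i j) (unit r j) ⟩
      unit i j - unit r j
        ≡⟨ cong₂ _-_ (unit-↑ˡ i j) (unit-↑ˡ r j) ⟨
      unit (i ↑ˡ m) (j ↑ˡ m) - unit (r ↑ˡ m) (j ↑ˡ m) ∎
    ... | inʳ k = begin
      lap tri (extend (M i) (λ _ → 0ℚ)) (n ↑ʳ k) ≡⟨ lap-extend-new (M i) (λ _ → 0ℚ) k ⟩
      0ℚ + 0ℚ                                    ≡⟨ cong₂ _-_ (unit-↑ˡ↑ʳ i k) (unit-↑ˡ↑ʳ r k) ⟨
      unit (i ↑ˡ m) (n ↑ʳ k) - unit (r ↑ˡ m) (n ↑ʳ k) ∎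

    new-source : ∀ e → IsPotential tri (n ↑ʳ e) (r ↑ˡ m) (extend (midGreen e) (kick e))
    new-source e a with ↑-view n m a
    ... | inˡ j = begin
      lap tri (extend (midGreen e) (kick e)) (j ↑ˡ m)
        ≡⟨ lap-extend-old (midGreen e) (kick e) j ⟩
      lap es (midGreen e) j - ∑[ k < m ] (kick e k * degEdge (lookup es k) j)
        ≡⟨ cong₂ _-_ (lap-affine es ½ ½ 0ℚ (M (end₁ e)) (M (end₂ e)) j)
             (trans (sum-cong-≗ {m} (λ k → kick-* (does (e Fin.≟ k)) (degEdge (lookup es k) j)))
                    (∑-when-≟ e (λ k → ½ * degEdge (lookup es k) j))) ⟩
      ½ * lap es (M (end₁ e)) j + ½ * lap es (M (end₂ e)) j - ½ * degEdge (lookup es e) j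
        ≡⟨ cong₂ (λ p q → ½ * p + ½ * q - ½ * degEdge (lookup es e) j)
             (M-isGreen (end₁ e) j) (M-isGreen (end₂ e) j) ⟩
      ½ * (unit (end₁ e) j - unit r j) + ½ * (unit (end₂ e) j - unit r j) - ½ * (unit (end₁ e) j + unit (end₂ e) j)
        ≡⟨ solve 3 (λ p q s → con ½ :* (p :- s) :+ con ½ :* (q :- s) :- con ½ :* (p :+ q) := con 0ℚ :- s)
             refl (unit (end₁ e) j) (unit (end₂ e) j) (unit r j) ⟩
      0ℚ - unit r j
        ≡⟨ cong₂ _-_ (unit-↑ʳ↑ˡ j e) (unit-↑ˡ r j) ⟨
      unit (n ↑ʳ e) (j ↑ˡ m) - unit (r ↑ˡ m) (j ↑ˡ m) ∎
      where
      kick-* : ∀ d p → when d ½ * p ≡ when d (½ * p)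
      kick-* true  p = refl
      kick-* false p = Qₚ.*-zeroˡ p
    ... | inʳ k = begin
      lap tri (extend (midGreen e) (kick e)) (n ↑ʳ k) ≡⟨ lap-extend-new (midGreen e) (kick e) k ⟩
      kick e k + kick e k                             ≡⟨ halves (does (e Fin.≟ k)) ⟩
      when (does (e Fin.≟ k)) 1ℚ - 0ℚ                 ≡⟨ cong₂ _-_ (unit-↑ʳ {n} e k) (unit-↑ˡ↑ʳ r k) ⟨
      unit (n ↑ʳ e) (n ↑ʳ k) - unit (r ↑ˡ m) (n ↑ʳ k) ∎
      where
      halves : ∀ d → when d ½ + when d ½ ≡ when d 1ℚ - 0ℚ
      halves true  = refl
      halves false = refl

    triGreen-isGreen : IsGreen tri (r ↑ˡ m) triGreen
    triGreen-isGreen a k with ↑-view n m a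
    ... | inˡ i = trans (cong (λ y → lap tri y k) (triGreen-old i)) (old-source i k)
    ... | inʳ e = trans (cong (λ y → lap tri y k) (triGreen-new e)) (new-source e k)

    triGreen-old-old : ∀ i j → triGreen (i ↑ˡ m) (j ↑ˡ m) ≡ ⅔ * M i j
    triGreen-old-old i j = trans (cong (λ y → y (j ↑ˡ m)) (triGreen-old i)) (extend-old (M i) (λ _ → 0ℚ) j)

    triGreen-old-new : ∀ i k → triGreen (i ↑ˡ m) (n ↑ʳ k) ≡ ⅓ * (M i (end₁ k) + M i (end₂ k)) + 0ℚ
    triGreen-old-new i k = trans (cong (λ y → y (n ↑ʳ k)) (triGreen-old i)) (extend-new (M i) (λ _ → 0ℚ) k)

    triGreen-new-old : ∀ e j → triGreen (n ↑ʳ e) (j ↑ˡ m) ≡ ⅔ * midGreen e j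
    triGreen-new-old e j = trans (cong (λ y → y (j ↑ˡ m)) (triGreen-new e)) (extend-old (midGreen e) (kick e) j)

    triGreen-new-new : ∀ e k → triGreen (n ↑ʳ e) (n ↑ʳ k) ≡ ⅓ * (midGreen e (end₁ k) + midGreen e (end₂ k)) + kick e k
    triGreen-new-new e k = trans (cong (λ y → y (n ↑ʳ k)) (triGreen-new e)) (extend-new (midGreen e) (kick e) k)

    triGreen-root : ∀ a → triGreen a (r ↑ˡ m) ≡ 0ℚ
    triGreen-root a with ↑-view n m a
    ... | inˡ i = begin
      triGreen (i ↑ˡ m) (r ↑ˡ m)  ≡⟨ triGreen-old-old i r ⟩
      ⅔ * M i r                   ≡⟨ cong (⅔ *_) (M-root i) ⟩
      ⅔ * 0ℚ                      ≡⟨ Qₚ.*-zeroʳ ⅔ ⟩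
      0ℚ                          ∎
    ... | inʳ e = begin
      triGreen (n ↑ʳ e) (r ↑ˡ m)                            ≡⟨ triGreen-new-old e r ⟩
      ⅔ * (½ * M (end₁ e) r + ½ * M (end₂ e) r + 0ℚ)        ≡⟨ cong₂ (λ p q → ⅔ * (½ * p + ½ * q + 0ℚ))
                                                                (M-root (end₁ e)) (M-root (end₂ e)) ⟩
      ⅔ * (½ * 0ℚ + ½ * 0ℚ + 0ℚ)                            ≡⟨⟩
      0ℚ                                                    ∎

    midGreen-endpoints : ∀ e → midGreen e (end₁ e) + midGreen e (end₂ e)
      ≡ (M (end₁ e) (end₁ e) + M (end₂ e) (end₂ e)) - ½ * resistanceOf M (end₁ e) (end₂ e)
    midGreen-endpoints e = solve 4 (λ uu uv vu vv →
      con ½ :* uu :+ con ½ :* vu :+ con 0ℚ :+ (con ½ :* uv :+ con ½ :* vv :+ con 0ℚ)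
      := (uu :+ vv) :- con ½ :* (uu :- vu :- uv :+ vv)) refl (M u u) (M u v) (M v u) (M v v)
      where u = end₁ e
            v = end₂ e

  ∑-endpoints : ∀ (φ : Fin n → ℚ) → ∑[ k < m ] (φ (end₁ k) + φ (end₂ k)) ≡ ∑[ i < n ] (degℚ es i * φ i)
  ∑-endpoints φ = sym (begin
    ∑[ i < n ] (degℚ es i * φ i)
      ≡⟨ sum-cong-≗ {n} (λ i → trans (cong (_* φ i) (degEdge-sum i)) (*-distribʳ-sum (φ i) (λ k → degEdge (lookup es k) i))) ⟩
    ∑[ i < n ] ∑[ k < m ] (degEdge (lookup es k) i * φ i)
      ≡⟨ ∑-comm (λ i k → degEdge (lookup es k) i * φ i) ⟩
    ∑[ k < m ] ∑[ i < n ] (degEdge (lookup es k) i * φ i)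
      ≡⟨ sum-cong-≗ {m} edge-sum ⟩
    ∑[ k < m ] (φ (end₁ k) + φ (end₂ k)) ∎)
    where
    indicator-* : ∀ d p → when d 1ℚ * p ≡ when d p
    indicator-* true  p = Qₚ.*-identityˡ p
    indicator-* false p = Qₚ.*-zeroˡ p
    edge-sum : ∀ k → ∑[ i < n ] (degEdge (lookup es k) i * φ i) ≡ φ (end₁ k) + φ (end₂ k)
    edge-sum k = begin
      ∑[ i < n ] ((at₁ i + at₂ i) * φ i)
        ≡⟨ sum-cong-≗ {n} (λ i → trans (Qₚ.*-distribʳ-+ (φ i) (at₁ i) (at₂ i))
             (cong₂ _+_ (indicator-* (does (end₁ k Fin.≟ i)) (φ i)) (indicator-* (does (end₂ k Fin.≟ i)) (φ i)))) ⟩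
      ∑[ i < n ] (when (does (end₁ k Fin.≟ i)) (φ i) + when (does (end₂ k Fin.≟ i)) (φ i))
        ≡⟨ ∑-distrib-+ (λ i → when (does (end₁ k Fin.≟ i)) (φ i)) (λ i → when (does (end₂ k Fin.≟ i)) (φ i)) ⟩
      ∑[ i < n ] when (does (end₁ k Fin.≟ i)) (φ i) + ∑[ i < n ] when (does (end₂ k Fin.≟ i)) (φ i)
        ≡⟨ cong₂ _+_ (∑-when-≟ (end₁ k) φ) (∑-when-≟ (end₂ k) φ) ⟩
      φ (end₁ k) + φ (end₂ k) ∎
      where
      at₁ at₂ : Fin n → ℚ
      at₁ i = when (does (end₁ k Fin.≟ i)) 1ℚ
      at₂ i = when (does (end₂ k Fin.≟ i)) 1ℚ

  handshake : sum (degℚ es) ≡ ℕ→ℚ 2 * ℕ→ℚ m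
  handshake = begin
    sum (degℚ es)                      ≡⟨ sum-cong-≗ {n} (λ i → Qₚ.*-identityʳ (degℚ es i)) ⟨
    ∑[ i < n ] (degℚ es i * 1ℚ)        ≡⟨ ∑-endpoints (λ _ → 1ℚ) ⟨
    ∑[ k < m ] (1ℚ + 1ℚ)               ≡⟨ ∑-const m (1ℚ + 1ℚ) ⟩
    ℕ→ℚ m * (1ℚ + 1ℚ)                  ≡⟨ Qₚ.*-comm (ℕ→ℚ m) (1ℚ + 1ℚ) ⟩
    ℕ→ℚ 2 * ℕ→ℚ m                      ∎

-- The additive degree-Kirchhoff index of the triangulation

module TriangulationIndex {n : ℕ} (es : EdgeList n) (connected : Connected es)
         {Ω : Fin n → Fin n → ℚ} (resistance : IsResistance es Ω) (r : Fin n) where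

  open Triangulation es
  open Green resistance r

  d : Fin n → ℚ
  d = degℚ es

  nℚ mℚ T₀ T₁ P₁ P₂ : ℚ
  nℚ = ℕ→ℚ n
  mℚ = ℕ→ℚ m
  T₀ = ∑[ i < n ] M i i
  T₁ = ∑[ i < n ] (d i * M i i)
  P₁ = ∑[ i < n ] ∑[ j < n ] (d i * M i j)
  P₂ = ∑[ i < n ] ∑[ j < n ] (d i * d j * M i j)

  M-sym : ∀ a b → M a b ≡ M b a
  M-sym = green-sym es r M-isGreen M-root

  Rplus-G : Rplus es Ω ≡ nℚ * T₁ - P₁ - P₁ + (ℕ→ℚ 2 * mℚ) * T₀
  Rplus-G = trans (Rplus-green es (resistance-green es r M-isGreen connected resistance) M-sym)
                  (cong (λ D → nℚ * T₁ - P₁ - P₁ + D * T₀) handshake)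

  Rstar-G : Rstar es Ω + Rstar es Ω ≡ (ℕ→ℚ 2 * mℚ) * T₁ - P₂ - P₂ + (ℕ→ℚ 2 * mℚ) * T₁
  Rstar-G = trans (Rstar-green es (resistance-green es r M-isGreen connected resistance) M-sym)
                  (cong (λ D → D * T₁ - P₂ - P₂ + D * T₁) handshake)

  edge-resistances : ∑[ k < m ] resistanceOf M (end₁ k) (end₂ k) ≡ nℚ - 1ℚ
  edge-resistances = trans (∑ₗ-lookup es (λ e → resistanceOf M (proj₁ e) (proj₂ e))) (foster es r M-isGreen)

  ∑-endpoint-diagonals : ∑[ k < m ] (M (end₁ k) (end₁ k) + M (end₂ k) (end₂ k)) ≡ T₁
  ∑-endpoint-diagonals = ∑-endpoints (λ i → M i i)

  triGreen-apex : ∀ e → triGreen (n ↑ʳ e) (n ↑ʳ e)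
    ≡ ⅓ * (M (end₁ e) (end₁ e) + M (end₂ e) (end₂ e)) + (- ⅙) * resistanceOf M (end₁ e) (end₂ e) + ½
  triGreen-apex e = begin
    triGreen (n ↑ʳ e) (n ↑ʳ e)
      ≡⟨ triGreen-new-new e e ⟩
    ⅓ * (midGreen e (end₁ e) + midGreen e (end₂ e)) + kick e e
      ≡⟨ cong₂ (λ s k → ⅓ * s + k) (midGreen-endpoints e) (cong (λ b → when b ½) (dec-true (e Fin.≟ e) refl)) ⟩
    ⅓ * ((M (end₁ e) (end₁ e) + M (end₂ e) (end₂ e)) - ½ * resistanceOf M (end₁ e) (end₂ e)) + ½
      ≡⟨ solve 2 (λ s ρ → con ⅓ :* (s :- con ½ :* ρ) :+ con ½ := con ⅓ :* s :+ con (- ⅙) :* ρ :+ con ½)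
           refl (M (end₁ e) (end₁ e) + M (end₂ e) (end₂ e)) (resistanceOf M (end₁ e) (end₂ e)) ⟩
    ⅓ * (M (end₁ e) (end₁ e) + M (end₂ e) (end₂ e)) + (- ⅙) * resistanceOf M (end₁ e) (end₂ e) + ½ ∎

  private
    S R : Fin m → ℚ
    S e = M (end₁ e) (end₁ e) + M (end₂ e) (end₂ e)
    R e = resistanceOf M (end₁ e) (end₂ e)

  ∑-degree-tri : sum (degℚ tri) ≡ ℕ→ℚ 6 * mℚ
  ∑-degree-tri = begin
    sum (degℚ tri)
      ≡⟨ ∑-↑ n m (degℚ tri) ⟩
    ∑[ i < n ] degℚ tri (i ↑ˡ m) + ∑[ k < m ] degℚ tri (n ↑ʳ k)
      ≡⟨ cong₂ _+_ (trans (sum-cong-≗ {n} deg-old) (sym (*-distribˡ-sum (ℕ→ℚ 2) d))) (trans (sum-cong-≗ {m} deg-new) (∑-const m (ℕ→ℚ 2))) ⟩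
    ℕ→ℚ 2 * sum d + mℚ * ℕ→ℚ 2
      ≡⟨ cong (λ D → ℕ→ℚ 2 * D + mℚ * ℕ→ℚ 2) handshake ⟩
    ℕ→ℚ 2 * (ℕ→ℚ 2 * mℚ) + mℚ * ℕ→ℚ 2
      ≡⟨ solve 1 (λ m → con (ℕ→ℚ 2) :* (con (ℕ→ℚ 2) :* m) :+ m :* con (ℕ→ℚ 2) := con (ℕ→ℚ 6) :* m) refl mℚ ⟩
    ℕ→ℚ 6 * mℚ ∎

  ∑-triGreen-diagonal : ∑[ a < N ] triGreen a a ≡ ⅔ * T₀ + ⅓ * T₁ - ⅙ * (nℚ - 1ℚ) + ½ * mℚ
  ∑-triGreen-diagonal = begin
    ∑[ a < N ] triGreen a a
      ≡⟨ ∑-↑ n m (λ a → triGreen a a) ⟩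
    ∑[ i < n ] triGreen (i ↑ˡ m) (i ↑ˡ m) + ∑[ e < m ] triGreen (n ↑ʳ e) (n ↑ʳ e)
      ≡⟨ cong₂ _+_ (trans (sum-cong-≗ {n} (λ i → triGreen-old-old i i)) (sym (*-distribˡ-sum ⅔ (λ i → M i i))))
                   (trans (sum-cong-≗ {m} triGreen-apex) (∑-affine ⅓ (- ⅙) ½ S R)) ⟩
    ⅔ * T₀ + (⅓ * sum S + (- ⅙) * sum R + mℚ * ½)
      ≡⟨ cong₂ (λ s ρ → ⅔ * T₀ + (⅓ * s + (- ⅙) * ρ + mℚ * ½)) ∑-endpoint-diagonals edge-resistances ⟩
    ⅔ * T₀ + (⅓ * T₁ + (- ⅙) * (nℚ - 1ℚ) + mℚ * ½)
      ≡⟨ solve 4 (λ t₀ t₁ n m → con ⅔ :* t₀ :+ (con ⅓ :* t₁ :+ con (- ⅙) :* (n :- con 1ℚ) :+ m :* con ½)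
                               := con ⅔ :* t₀ :+ con ⅓ :* t₁ :- con ⅙ :* (n :- con 1ℚ) :+ con ½ :* m) refl T₀ T₁ nℚ mℚ ⟩
    ⅔ * T₀ + ⅓ * T₁ - ⅙ * (nℚ - 1ℚ) + ½ * mℚ ∎

  ∑-deg-triGreen-diagonal : ∑[ a < N ] (degℚ tri a * triGreen a a) ≡ ℕ→ℚ 2 * T₁ - ⅓ * (nℚ - 1ℚ) + mℚ
  ∑-deg-triGreen-diagonal = begin
    ∑[ a < N ] (degℚ tri a * triGreen a a)
      ≡⟨ ∑-↑ n m (λ a → degℚ tri a * triGreen a a) ⟩
    ∑[ i < n ] (degℚ tri (i ↑ˡ m) * triGreen (i ↑ˡ m) (i ↑ˡ m)) + ∑[ e < m ] (degℚ tri (n ↑ʳ e) * triGreen (n ↑ʳ e) (n ↑ʳ e))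
      ≡⟨ cong₂ _+_ (sum-cong-≗ {n} (λ i → trans (cong₂ _*_ (deg-old i) (triGreen-old-old i i))
                     (solve 2 (λ δ μ → con (ℕ→ℚ 2) :* δ :* (con ⅔ :* μ) := con (ℕ→ℚ 2 * ⅔) :* (δ :* μ)) refl (d i) (M i i))))
                   (sum-cong-≗ {m} (λ e → trans (cong₂ _*_ (deg-new e) (triGreen-apex e))
                     (solve 2 (λ s ρ → con (ℕ→ℚ 2) :* (con ⅓ :* s :+ con (- ⅙) :* ρ :+ con ½)
                                      := con ⅔ :* s :+ con (- ⅓) :* ρ :+ con 1ℚ) refl (S e) (R e)))) ⟩
    ∑[ i < n ] ((ℕ→ℚ 2 * ⅔) * (d i * M i i)) + ∑[ e < m ] (⅔ * S e + (- ⅓) * R e + 1ℚ)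
      ≡⟨ cong₂ _+_ (sym (*-distribˡ-sum (ℕ→ℚ 2 * ⅔) (λ i → d i * M i i))) (∑-affine ⅔ (- ⅓) 1ℚ S R) ⟩
    (ℕ→ℚ 2 * ⅔) * T₁ + (⅔ * sum S + (- ⅓) * sum R + mℚ * 1ℚ)
      ≡⟨ cong₂ (λ s ρ → (ℕ→ℚ 2 * ⅔) * T₁ + (⅔ * s + (- ⅓) * ρ + mℚ * 1ℚ)) ∑-endpoint-diagonals edge-resistances ⟩
    (ℕ→ℚ 2 * ⅔) * T₁ + (⅔ * T₁ + (- ⅓) * (nℚ - 1ℚ) + mℚ * 1ℚ)
      ≡⟨ solve 3 (λ t₁ n m → con (ℕ→ℚ 2 * ⅔) :* t₁ :+ (con ⅔ :* t₁ :+ con (- ⅓) :* (n :- con 1ℚ) :+ m :* con 1ℚ)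
                            := con (ℕ→ℚ 2) :* t₁ :- con ⅓ :* (n :- con 1ℚ) :+ m) refl T₁ nℚ mℚ ⟩
    ℕ→ℚ 2 * T₁ - ⅓ * (nℚ - 1ℚ) + mℚ ∎

  triGreen-row-old : ∀ i → ∑[ b < N ] triGreen (i ↑ˡ m) b ≡ ⅔ * ∑[ j < n ] M i j + ⅓ * ∑[ j < n ] (d j * M i j)
  triGreen-row-old i = begin
    ∑[ b < N ] triGreen (i ↑ˡ m) b
      ≡⟨ ∑-↑ n m (triGreen (i ↑ˡ m)) ⟩
    ∑[ j < n ] triGreen (i ↑ˡ m) (j ↑ˡ m) + ∑[ k < m ] triGreen (i ↑ˡ m) (n ↑ʳ k)
      ≡⟨ cong₂ _+_ (trans (sum-cong-≗ {n} (triGreen-old-old i)) (sym (*-distribˡ-sum ⅔ (M i))))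
                   (trans (sum-cong-≗ {m} (λ k → trans (triGreen-old-new i k) (Qₚ.+-identityʳ _)))
                          (trans (sym (*-distribˡ-sum ⅓ (λ k → M i (end₁ k) + M i (end₂ k)))) (cong (⅓ *_) (∑-endpoints (M i))))) ⟩
    ⅔ * ∑[ j < n ] M i j + ⅓ * ∑[ j < n ] (d j * M i j) ∎

  triGreen-row-new : ∀ e → ∑[ b < N ] triGreen (n ↑ʳ e) b
    ≡ ⅔ * ∑[ j < n ] midGreen e j + ⅓ * ∑[ j < n ] (d j * midGreen e j) + ½
  triGreen-row-new e = begin
    ∑[ b < N ] triGreen (n ↑ʳ e) b
      ≡⟨ ∑-↑ n m (triGreen (n ↑ʳ e)) ⟩
    ∑[ j < n ] triGreen (n ↑ʳ e) (j ↑ˡ m) + ∑[ k < m ] triGreen (n ↑ʳ e) (n ↑ʳ k)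
      ≡⟨ cong₂ _+_ (trans (sum-cong-≗ {n} (triGreen-new-old e)) (sym (*-distribˡ-sum ⅔ (midGreen e))))
                   (trans (sum-cong-≗ {m} (triGreen-new-new e))
                          (∑-distrib-+ (λ k → ⅓ * (midGreen e (end₁ k) + midGreen e (end₂ k))) (kick e))) ⟩
    ⅔ * ∑[ j < n ] midGreen e j + (∑[ k < m ] (⅓ * (midGreen e (end₁ k) + midGreen e (end₂ k))) + sum (kick e))
      ≡⟨ cong₂ (λ p q → ⅔ * ∑[ j < n ] midGreen e j + (p + q))
           (trans (sym (*-distribˡ-sum ⅓ (λ k → midGreen e (end₁ k) + midGreen e (end₂ k)))) (cong (⅓ *_) (∑-endpoints (midGreen e))))
           (∑-when-≟ e (λ _ → ½)) ⟩
    ⅔ * ∑[ j < n ] midGreen e j + (⅓ * ∑[ j < n ] (d j * midGreen e j) + ½)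
      ≡⟨ Qₚ.+-assoc (⅔ * ∑[ j < n ] midGreen e j) (⅓ * ∑[ j < n ] (d j * midGreen e j)) ½ ⟨
    ⅔ * ∑[ j < n ] midGreen e j + ⅓ * ∑[ j < n ] (d j * midGreen e j) + ½ ∎

  ∑-midGreen : ∀ j → ∑[ e < m ] midGreen e j ≡ ½ * ∑[ i < n ] (d i * M i j)
  ∑-midGreen j = begin
    ∑[ e < m ] midGreen e j
      ≡⟨ sum-cong-≗ {m} (λ e → solve 2 (λ a b → con ½ :* a :+ con ½ :* b :+ con 0ℚ := con ½ :* (a :+ b)) refl (M (end₁ e) j) (M (end₂ e) j)) ⟩
    ∑[ e < m ] (½ * (M (end₁ e) j + M (end₂ e) j))
      ≡⟨ *-distribˡ-sum ½ (λ e → M (end₁ e) j + M (end₂ e) j) ⟨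
    ½ * ∑[ e < m ] (M (end₁ e) j + M (end₂ e) j)
      ≡⟨ cong (½ *_) (∑-endpoints (λ i → M i j)) ⟩
    ½ * ∑[ i < n ] (d i * M i j) ∎

  ∑∑-midGreen : ∑[ e < m ] ∑[ j < n ] midGreen e j ≡ ½ * P₁
  ∑∑-midGreen = begin
    ∑[ e < m ] ∑[ j < n ] midGreen e j             ≡⟨ ∑-comm midGreen ⟩
    ∑[ j < n ] ∑[ e < m ] midGreen e j             ≡⟨ sum-cong-≗ {n} ∑-midGreen ⟩
    ∑[ j < n ] (½ * ∑[ i < n ] (d i * M i j))      ≡⟨ *-distribˡ-sum ½ (λ j → ∑[ i < n ] (d i * M i j)) ⟨
    ½ * ∑[ j < n ] ∑[ i < n ] (d i * M i j)        ≡⟨ cong (½ *_) (∑-comm (λ j i → d i * M i j)) ⟩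
    ½ * P₁                                         ∎

  ∑∑-deg-midGreen : ∑[ e < m ] ∑[ j < n ] (d j * midGreen e j) ≡ ½ * P₂
  ∑∑-deg-midGreen = begin
    ∑[ e < m ] ∑[ j < n ] (d j * midGreen e j)
      ≡⟨ ∑-comm (λ e j → d j * midGreen e j) ⟩
    ∑[ j < n ] ∑[ e < m ] (d j * midGreen e j)
      ≡⟨ sum-cong-≗ {n} (λ j → trans (sym (*-distribˡ-sum (d j) (λ e → midGreen e j))) (cong (d j *_) (∑-midGreen j))) ⟩
    ∑[ j < n ] (d j * (½ * ∑[ i < n ] (d i * M i j)))
      ≡⟨ sum-cong-≗ {n} (λ j → trans (cong (d j *_) (*-distribˡ-sum ½ (λ i → d i * M i j))) (*-distribˡ-sum (d j) (λ i → ½ * (d i * M i j)))) ⟩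
    ∑[ j < n ] ∑[ i < n ] (d j * (½ * (d i * M i j)))
      ≡⟨ ∑-comm (λ j i → d j * (½ * (d i * M i j))) ⟩
    ∑[ i < n ] ∑[ j < n ] (d j * (½ * (d i * M i j)))
      ≡⟨ sum-cong-≗ {n} (λ i → sum-cong-≗ {n} (λ j →
           solve 4 (λ a b μ h → a :* (h :* (b :* μ)) := h :* (b :* a :* μ)) refl (d j) (d i) (M i j) ½)) ⟩
    ∑[ i < n ] ∑[ j < n ] (½ * (d i * d j * M i j))
      ≡⟨ trans (sum-cong-≗ {n} (λ i → sym (*-distribˡ-sum ½ (λ j → d i * d j * M i j)))) (sym (*-distribˡ-sum ½ (λ i → ∑[ j < n ] (d i * d j * M i j)))) ⟩
    ½ * P₂ ∎

  ∑∑-deg-triGreen : ∑[ a < N ] ∑[ b < N ] (degℚ tri a * triGreen a b) ≡ ℕ→ℚ 2 * P₁ + P₂ + mℚ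
  ∑∑-deg-triGreen = begin
    ∑[ a < N ] ∑[ b < N ] (degℚ tri a * triGreen a b)
      ≡⟨ sum-cong-≗ {N} (λ a → sym (*-distribˡ-sum (degℚ tri a) (triGreen a))) ⟩
    ∑[ a < N ] (degℚ tri a * ∑[ b < N ] triGreen a b)
      ≡⟨ ∑-↑ n m (λ a → degℚ tri a * ∑[ b < N ] triGreen a b) ⟩
    ∑[ i < n ] (degℚ tri (i ↑ˡ m) * ∑[ b < N ] triGreen (i ↑ˡ m) b) + ∑[ e < m ] (degℚ tri (n ↑ʳ e) * ∑[ b < N ] triGreen (n ↑ʳ e) b)
      ≡⟨ cong₂ _+_ (sum-cong-≗ {n} (λ i → trans (cong₂ _*_ (deg-old i) (triGreen-row-old i)) (old-row i)))
                   (sum-cong-≗ {m} (λ e → trans (cong₂ _*_ (deg-new e) (triGreen-row-new e))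
                     (solve 2 (λ p q → con (ℕ→ℚ 2) :* (con ⅔ :* p :+ con ⅓ :* q :+ con ½)
                                      := con (ℕ→ℚ 2 * ⅔) :* p :+ con (ℕ→ℚ 2 * ⅓) :* q :+ con (ℕ→ℚ 2 * ½))
                       refl (∑[ j < n ] midGreen e j) (∑[ j < n ] (d j * midGreen e j))))) ⟩
    ∑[ i < n ] ((ℕ→ℚ 2 * ⅔) * ∑[ j < n ] (d i * M i j) + (ℕ→ℚ 2 * ⅓) * ∑[ j < n ] (d i * d j * M i j) + 0ℚ)
      + ∑[ e < m ] ((ℕ→ℚ 2 * ⅔) * ∑[ j < n ] midGreen e j + (ℕ→ℚ 2 * ⅓) * ∑[ j < n ] (d j * midGreen e j) + ℕ→ℚ 2 * ½)
      ≡⟨ cong₂ _+_ (trans (∑-affine (ℕ→ℚ 2 * ⅔) (ℕ→ℚ 2 * ⅓) 0ℚ (λ i → ∑[ j < n ] (d i * M i j)) (λ i → ∑[ j < n ] (d i * d j * M i j)))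
                     (trans (cong ((ℕ→ℚ 2 * ⅔) * P₁ + (ℕ→ℚ 2 * ⅓) * P₂ +_) (Qₚ.*-zeroʳ nℚ)) (Qₚ.+-identityʳ ((ℕ→ℚ 2 * ⅔) * P₁ + (ℕ→ℚ 2 * ⅓) * P₂))))
                   (∑-affine (ℕ→ℚ 2 * ⅔) (ℕ→ℚ 2 * ⅓) (ℕ→ℚ 2 * ½) (λ e → ∑[ j < n ] midGreen e j) (λ e → ∑[ j < n ] (d j * midGreen e j))) ⟩
    (ℕ→ℚ 2 * ⅔) * P₁ + (ℕ→ℚ 2 * ⅓) * P₂
      + ((ℕ→ℚ 2 * ⅔) * ∑[ e < m ] ∑[ j < n ] midGreen e j + (ℕ→ℚ 2 * ⅓) * ∑[ e < m ] ∑[ j < n ] (d j * midGreen e j) + mℚ * (ℕ→ℚ 2 * ½))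
      ≡⟨ cong₂ (λ p q → (ℕ→ℚ 2 * ⅔) * P₁ + (ℕ→ℚ 2 * ⅓) * P₂ + ((ℕ→ℚ 2 * ⅔) * p + (ℕ→ℚ 2 * ⅓) * q + mℚ * (ℕ→ℚ 2 * ½)))
           ∑∑-midGreen ∑∑-deg-midGreen ⟩
    (ℕ→ℚ 2 * ⅔) * P₁ + (ℕ→ℚ 2 * ⅓) * P₂ + ((ℕ→ℚ 2 * ⅔) * (½ * P₁) + (ℕ→ℚ 2 * ⅓) * (½ * P₂) + mℚ * (ℕ→ℚ 2 * ½))
      ≡⟨ solve 3 (λ p₁ p₂ m → con (ℕ→ℚ 2 * ⅔) :* p₁ :+ con (ℕ→ℚ 2 * ⅓) :* p₂
                              :+ (con (ℕ→ℚ 2 * ⅔) :* (con ½ :* p₁) :+ con (ℕ→ℚ 2 * ⅓) :* (con ½ :* p₂) :+ m :* con (ℕ→ℚ 2 * ½))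
                              := con (ℕ→ℚ 2) :* p₁ :+ p₂ :+ m) refl P₁ P₂ mℚ ⟩
    ℕ→ℚ 2 * P₁ + P₂ + mℚ ∎
    where
    old-row : ∀ i → ℕ→ℚ 2 * d i * (⅔ * ∑[ j < n ] M i j + ⅓ * ∑[ j < n ] (d j * M i j))
      ≡ (ℕ→ℚ 2 * ⅔) * ∑[ j < n ] (d i * M i j) + (ℕ→ℚ 2 * ⅓) * ∑[ j < n ] (d i * d j * M i j) + 0ℚ
    old-row i = begin
      ℕ→ℚ 2 * d i * (⅔ * ∑[ j < n ] M i j + ⅓ * ∑[ j < n ] (d j * M i j))
        ≡⟨ solve 3 (λ δ p q → con (ℕ→ℚ 2) :* δ :* (con ⅔ :* p :+ con ⅓ :* q) := con (ℕ→ℚ 2 * ⅔) :* (δ :* p) :+ con (ℕ→ℚ 2 * ⅓) :* (δ :* q) :+ con 0ℚ)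
             refl (d i) (∑[ j < n ] M i j) (∑[ j < n ] (d j * M i j)) ⟩
      (ℕ→ℚ 2 * ⅔) * (d i * ∑[ j < n ] M i j) + (ℕ→ℚ 2 * ⅓) * (d i * ∑[ j < n ] (d j * M i j)) + 0ℚ
        ≡⟨ cong₂ (λ p q → (ℕ→ℚ 2 * ⅔) * p + (ℕ→ℚ 2 * ⅓) * q + 0ℚ) (*-distribˡ-sum (d i) (M i))
             (trans (*-distribˡ-sum (d i) (λ j → d j * M i j)) (sum-cong-≗ {n} (λ j → sym (Qₚ.*-assoc (d i) (d j) (M i j))))) ⟩
      (ℕ→ℚ 2 * ⅔) * ∑[ j < n ] (d i * M i j) + (ℕ→ℚ 2 * ⅓) * ∑[ j < n ] (d i * d j * M i j) + 0ℚ ∎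

  Rplus-triangulation : ∀ {ΩT} → IsResistance tri ΩT →
    Rplus tri ΩT ≡ ℕ→ℚ 2 * Rplus es Ω + ℕ→ℚ 2 * Rstar es Ω
      + ((ℕ→ℚ 12 * mℚ * mℚ + nℚ) - (mℚ * nℚ + nℚ * nℚ + ℕ→ℚ 2 * mℚ)) * ⅓
  Rplus-triangulation {ΩT} resistanceT = begin
    Rplus tri ΩT
      ≡⟨ Rplus-green tri (resistance-green tri (r ↑ˡ m) triGreen-isGreen (tri-connected connected) resistanceT)
                         (green-sym tri (r ↑ˡ m) triGreen-isGreen triGreen-root) ⟩
    ℕ→ℚ N * ∑[ a < N ] (degℚ tri a * triGreen a a)
      - ∑[ a < N ] ∑[ b < N ] (degℚ tri a * triGreen a b) - ∑[ a < N ] ∑[ b < N ] (degℚ tri a * triGreen a b)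
      + sum (degℚ tri) * ∑[ a < N ] triGreen a a
      ≡⟨ cong₂ (λ x p → x - p - p + sum (degℚ tri) * ∑[ a < N ] triGreen a a)
           (cong₂ _*_ (ℕ→ℚ-+ n m) ∑-deg-triGreen-diagonal) ∑∑-deg-triGreen ⟩
    (nℚ + mℚ) * (ℕ→ℚ 2 * T₁ - ⅓ * (nℚ - 1ℚ) + mℚ) - (ℕ→ℚ 2 * P₁ + P₂ + mℚ) - (ℕ→ℚ 2 * P₁ + P₂ + mℚ)
      + sum (degℚ tri) * ∑[ a < N ] triGreen a a
      ≡⟨ cong₂ (λ D t → (nℚ + mℚ) * (ℕ→ℚ 2 * T₁ - ⅓ * (nℚ - 1ℚ) + mℚ) - (ℕ→ℚ 2 * P₁ + P₂ + mℚ) - (ℕ→ℚ 2 * P₁ + P₂ + mℚ) + D * t)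
           ∑-degree-tri ∑-triGreen-diagonal ⟩
    (nℚ + mℚ) * (ℕ→ℚ 2 * T₁ - ⅓ * (nℚ - 1ℚ) + mℚ) - (ℕ→ℚ 2 * P₁ + P₂ + mℚ) - (ℕ→ℚ 2 * P₁ + P₂ + mℚ)
      + ℕ→ℚ 6 * mℚ * (⅔ * T₀ + ⅓ * T₁ - ⅙ * (nℚ - 1ℚ) + ½ * mℚ)
      ≡⟨ solve 6 (λ n m t₀ t₁ p₁ p₂ →
           (n :+ m) :* (two :* t₁ :- con ⅓ :* (n :- con 1ℚ) :+ m) :- (two :* p₁ :+ p₂ :+ m) :- (two :* p₁ :+ p₂ :+ m)
           :+ con (ℕ→ℚ 6) :* m :* (con ⅔ :* t₀ :+ con ⅓ :* t₁ :- con ⅙ :* (n :- con 1ℚ) :+ con ½ :* m)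
           := two :* (n :* t₁ :- p₁ :- p₁ :+ (two :* m) :* t₀) :+ ((two :* m) :* t₁ :- p₂ :- p₂ :+ (two :* m) :* t₁)
              :+ ((con (ℕ→ℚ 12) :* m :* m :+ n) :- (m :* n :+ n :* n :+ two :* m)) :* con ⅓)
           refl nℚ mℚ T₀ T₁ P₁ P₂ ⟩
    ℕ→ℚ 2 * (nℚ * T₁ - P₁ - P₁ + (ℕ→ℚ 2 * mℚ) * T₀) + ((ℕ→ℚ 2 * mℚ) * T₁ - P₂ - P₂ + (ℕ→ℚ 2 * mℚ) * T₁) + K
      ≡⟨ cong₂ (λ p q → ℕ→ℚ 2 * p + q + K) (sym Rplus-G) (sym Rstar-G) ⟩
    ℕ→ℚ 2 * Rplus es Ω + (Rstar es Ω + Rstar es Ω) + K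
      ≡⟨ cong (λ x → ℕ→ℚ 2 * Rplus es Ω + x + K) (solve 1 (λ x → x :+ x := two :* x) refl (Rstar es Ω)) ⟩
    ℕ→ℚ 2 * Rplus es Ω + ℕ→ℚ 2 * Rstar es Ω + K ∎
    where
    K : ℚ
    K = ((ℕ→ℚ 12 * mℚ * mℚ + nℚ) - (mℚ * nℚ + nℚ * nℚ + ℕ→ℚ 2 * mℚ)) * ⅓
    two : ∀ {k} → Polynomial k
    two = con (ℕ→ℚ 2)

constant-term : ∀ n m → (ℤ.+ (12 ℕ.* m ℕ.* m ℕ.+ n) ℤ.- ℤ.+ (m ℕ.* n ℕ.+ n ℕ.* n ℕ.+ 2 ℕ.* m)) / 3
  ≡ ((ℕ→ℚ 12 * ℕ→ℚ m * ℕ→ℚ m + ℕ→ℚ n) - (ℕ→ℚ m * ℕ→ℚ n + ℕ→ℚ n * ℕ→ℚ n + ℕ→ℚ 2 * ℕ→ℚ m)) * ⅓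
constant-term n m = begin
  (ℤ.+ X ℤ.- ℤ.+ Y) / 3              ≡⟨ /3≡/1*⅓ (ℤ.+ X ℤ.- ℤ.+ Y) ⟩
  ((ℤ.+ X ℤ.- ℤ.+ Y) / 1) * ⅓        ≡⟨ cong (_* ⅓) (/1-homo-minus (ℤ.+ X) (ℤ.+ Y)) ⟩
  (ℕ→ℚ X - ℕ→ℚ Y) * ⅓                ≡⟨ cong (_* ⅓) (cong₂ _-_ X≡ Y≡) ⟩
  ((ℕ→ℚ 12 * ℕ→ℚ m * ℕ→ℚ m + ℕ→ℚ n) - (ℕ→ℚ m * ℕ→ℚ n + ℕ→ℚ n * ℕ→ℚ n + ℕ→ℚ 2 * ℕ→ℚ m)) * ⅓ ∎
  where
  X = 12 ℕ.* m ℕ.* m ℕ.+ n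
  Y = m ℕ.* n ℕ.+ n ℕ.* n ℕ.+ 2 ℕ.* m
  X≡ : ℕ→ℚ X ≡ ℕ→ℚ 12 * ℕ→ℚ m * ℕ→ℚ m + ℕ→ℚ n
  X≡ = trans (ℕ→ℚ-+ (12 ℕ.* m ℕ.* m) n) (cong (_+ ℕ→ℚ n) (trans (ℕ→ℚ-* (12 ℕ.* m) m) (cong (_* ℕ→ℚ m) (ℕ→ℚ-* 12 m))))
  Y≡ : ℕ→ℚ Y ≡ ℕ→ℚ m * ℕ→ℚ n + ℕ→ℚ n * ℕ→ℚ n + ℕ→ℚ 2 * ℕ→ℚ m
  Y≡ = trans (ℕ→ℚ-+ (m ℕ.* n ℕ.+ n ℕ.* n) (2 ℕ.* m))
         (cong₂ _+_ (trans (ℕ→ℚ-+ (m ℕ.* n) (n ℕ.* n)) (cong₂ _+_ (ℕ→ℚ-* m n) (ℕ→ℚ-* n n))) (ℕ→ℚ-* 2 m))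

open import Data.Integer using (+_)

theorem4p4 : (n : ℕ) (es : EdgeList n) → 2 ℕ.≤ n → Simple es → Connected es →
    (Ω : Fin n → Fin n → ℚ) → IsResistance es Ω →
    (ΩT : Fin (n ℕ.+ length es) → Fin (n ℕ.+ length es) → ℚ) → IsResistance (triEdges es) ΩT →
    Rplus (triEdges es) ΩT
      ≡ ℕ→ℚ 2 * Rplus es Ω + ℕ→ℚ 2 * Rstar es Ω
        + ((+ (12 ℕ.* length es ℕ.* length es ℕ.+ n) ℤ.- + (length es ℕ.* n ℕ.+ n ℕ.* n ℕ.+ 2 ℕ.* length es)) / 3)
theorem4p4 n@(suc _) es _ _ connected Ω resistance ΩT resistanceT =
  trans (Rplus-triangulation resistanceT)
        (cong (λ K → ℕ→ℚ 2 * Rplus es Ω + ℕ→ℚ 2 * Rstar es Ω + K) (sym (constant-term n (length es))))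
  where open TriangulationIndex es connected resistance zero
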